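{- For an integer $k\geq 2$, let $G_k$ be the graph obtained from a cycle $C_{2k+1}$ on vertices $v_1,\dots,v_{2k+1}$ (edges $v_iv_{i+1}$ for $1\le i\le 2k$ and $v_{2k+1}v_1$) by adding the chords $v_iv_{i+k}$ for $i\in\{1,\dots,k\}$, and then adding three new vertices $y,x_1,x_2$ with edges $yv_{2k+1}$, $yx_1$, $yx_2$. Then $G_k$ is a connected graph on $n=2k+4$ vertices with $\alpha(G_k)=a(G_k)=k+2\geq \frac n2$, while $\alpha'(G_k)=2$. In particular, there exist connected graphs $G$ with $a(G)\geq\frac n2$ and $\alpha(G)=a(G)$ but $\alpha'(G)\neq a(G)$, and $\alpha(G)-\alpha'(G)$ can be arbitrarily large.
   Context: All graphs are finite and simple. $\alpha(G)$ denotes the independence number of $G$. For a set $S$ of vertices, $\mathcal{N}(S)$ denotes the set of vertices adjacent to at least one vertex of $S$. An independent set $I$ is critical if $|I|-|\mathcal{N}(I)|$ is maximum among all independent sets of $G$; the critical independence number $\alpha'(G)$ is the maximum cardinality of a critical independent set. The annihilation number $a(G)$: if $d_1\leq \dots\leq d_n$ are the vertex degrees of $G$ in nondecreasing order, $a(G)$ is the largest $k$ such that $\sum_{i=1}^k d_i\leq |E(G)|$. -}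

module Defs where

open import Data.Bool using (Bool; true; false; _∧_; _∨_; not; T)
open import Data.Bool.Properties using (∨-comm)
open import Data.Nat using (ℕ; zero; suc; _+_; _*_; _≤_; _<_; _≡ᵇ_; _<ᵇ_)
open import Data.Nat.Properties using (≤-decTotalOrder)
open import Data.Fin using (Fin; toℕ)
open import Data.Fin.Subset using (Subset; _∈_; ∣_∣)
open import Data.List using (List; take; map; filter; length; allFin)
open import Data.Nat.ListAction using (sum)
open import Data.Bool.ListAction using (any)
open import Data.Bool using (T?)
import Data.Vec
open import Data.Vec using (tabulate)
open import Data.Integer as ℤ using (ℤ; +_)
open import Data.Product using (Σ; ∃; _×_; _,_)
open import Relation.Binary.PropositionalEquality using (_≡_; refl; cong₂)
import Data.List.Sort.InsertionSort.Base as ISort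

record Graph (n : ℕ) : Set where
  field
    Adj    : Fin n → Fin n → Bool
    sym    : ∀ u v → Adj u v ≡ Adj v u
    irrefl : ∀ v → Adj v v ≡ false
open Graph public

module _ {n : ℕ} (G : Graph n) where

  Independent : Subset n → Set
  Independent S = ∀ u v → u ∈ S → v ∈ S → Adj G u v ≡ false

  Nbhd : Subset n → Subset n
  Nbhd S = tabulate (λ v → any (λ u → memb u ∧ Adj G u v) (allFin n))
    where
    memb : Fin n → Bool
    memb u = Data.Vec.lookup S u

  excess : Subset n → ℤ
  excess S = + ∣ S ∣ ℤ.- + ∣ Nbhd S ∣

  IsIndependenceNumber : ℕ → Set
  IsIndependenceNumber m =
    (∃ λ S → Independent S × ∣ S ∣ ≡ m) ×
    (∀ S → Independent S → ∣ S ∣ ≤ m)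

  Critical : Subset n → Set
  Critical I = Independent I × (∀ J → Independent J → excess J ℤ.≤ excess I)

  IsCriticalIndependenceNumber : ℕ → Set
  IsCriticalIndependenceNumber m =
    (∃ λ I → Critical I × ∣ I ∣ ≡ m) ×
    (∀ I → Critical I → ∣ I ∣ ≤ m)

  degree : Fin n → ℕ
  degree v = length (filter (λ u → T? (Adj G v u)) (allFin n))

  numEdges : ℕ
  numEdges = sum (map (λ u → length (filter (λ v → T? ((toℕ u <ᵇ toℕ v) ∧ Adj G u v)) (allFin n))) (allFin n))

  sortedDegrees : List ℕ
  sortedDegrees = ISort.sort ≤-decTotalOrder (map degree (allFin n))

  IsAnnihilationNumber : ℕ → Set
  IsAnnihilationNumber k =
    k ≤ n × sum (take k sortedDegrees) ≤ numEdges ×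
    (∀ j → j ≤ n → sum (take j sortedDegrees) ≤ numEdges → j ≤ k)

  data Reach (u : Fin n) : Fin n → Set where
    here : Reach u u
    step : ∀ {v w} → Reach u v → Adj G v w ≡ true → Reach u w

  Connected : Set
  Connected = ∀ u v → Reach u v

-- The graph G_k on 2k+4 vertices.
-- Vertex index i ∈ {0,…,2k} is v_{i+1}; 2k+1 is y; 2k+2 is x₁; 2k+3 is x₂.

baseEdge : ℕ → ℕ → ℕ → Bool
baseEdge k i j =
     ((j ≡ᵇ suc i) ∧ (i <ᵇ 2 * k))             -- v_{i+1} v_{i+2}, 1 ≤ i+1 ≤ 2k
  ∨ ((i ≡ᵇ 0) ∧ (j ≡ᵇ 2 * k))
  ∨ ((i <ᵇ k) ∧ (j ≡ᵇ i + k))                  -- chords v_{i+1} v_{i+1+k}, i+1 ∈ {1..k}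
  ∨ ((i ≡ᵇ 2 * k) ∧ (j ≡ᵇ 2 * k + 1))
  ∨ ((i ≡ᵇ 2 * k + 1) ∧ (j ≡ᵇ 2 * k + 2))
  ∨ ((i ≡ᵇ 2 * k + 1) ∧ (j ≡ᵇ 2 * k + 3))

≡ᵇ-sym : ∀ m n → (m ≡ᵇ n) ≡ (n ≡ᵇ m)
≡ᵇ-sym zero zero = refl
≡ᵇ-sym zero (suc n) = refl
≡ᵇ-sym (suc m) zero = refl
≡ᵇ-sym (suc m) (suc n) = ≡ᵇ-sym m n

GkAdj : (k : ℕ) → Fin (2 * k + 4) → Fin (2 * k + 4) → Bool
GkAdj k u v = not (toℕ u ≡ᵇ toℕ v) ∧
  (baseEdge k (toℕ u) (toℕ v) ∨ baseEdge k (toℕ v) (toℕ u))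

GkAdj-sym : ∀ k u v → GkAdj k u v ≡ GkAdj k v u
GkAdj-sym k u v = cong₂ (λ a b → not a ∧ b) (≡ᵇ-sym (toℕ u) (toℕ v))
  (∨-comm (baseEdge k (toℕ u) (toℕ v)) (baseEdge k (toℕ v) (toℕ u)))

≡ᵇ-refl : ∀ m → (m ≡ᵇ m) ≡ true
≡ᵇ-refl zero = refl
≡ᵇ-refl (suc m) = ≡ᵇ-refl m

GkAdj-irrefl : ∀ k v → GkAdj k v v ≡ false
GkAdj-irrefl k v rewrite ≡ᵇ-refl (toℕ v) = refl

G : (k : ℕ) → Graph (2 * k + 4)
G k = record { Adj = GkAdj k ; sym = GkAdj-sym k ; irrefl = GkAdj-irrefl k }

{-# OPTIONS --safe #-}
module Submission where

-- Every vertex except the leaves x₁, x₂ has degree 3, so the sorted degree sequence is 1, 1, 3, …, 3,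
-- the handshake lemma gives |E| = 3k + 4, and a = k + 2.
-- The key fact is a surplus on the odd cycle C = v₁ … v₂ₖ₊₁: if an independent set S meets C, then
-- |N(S) ∩ C| > |S ∩ C|. Indeed S shifted one step back along C lies in N(S) ∩ C; were it all of it,
-- S would be closed under rotation by two and, C being odd, would contain two adjacent vertices.
-- As S and N(S) are disjoint, |S ∩ C| ≤ k; adding the star y x₁ x₂ gives α ≤ k + 2 as well as
-- |S| − |N(S)| ≤ 1, and even |S| − |N(S)| ≤ 0 once |S| > 2. So {x₁, x₂}, of excess 1, is critical,
-- and no critical set has more than two vertices.

open import Defs hiding (sym)
open import Data.Nat using (ℕ; _+_; _*_; _≤_; _∸_)
open import Data.Product using (Σ; ∃; _×_)
open import Relation.Binary.PropositionalEquality using (_≡_; _≢_)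

open import Data.Bool using (Bool; true; false; _∧_; _∨_; not; T; T?; if_then_else_)
open import Data.Bool.ListAction using (any)
open import Data.Bool.Properties
  using (T-≡; T-∧; T-∨; T-not-≡; ¬-not; ∧-identityʳ; ∧-zeroʳ; ∧-conicalˡ; ∧-conicalʳ; ∨-inverseʳ; ∧-inverseʳ)
import Data.Bool.Properties as Bool
open import Data.Empty using (⊥; ⊥-elim)
open import Data.Fin using (Fin; toℕ; fromℕ<) renaming (zero to fzero; suc to fsuc)
open import Data.Fin.Properties using (toℕ-injective; toℕ<n; toℕ-fromℕ<; fromℕ<-toℕ)
open import Data.Fin.Subset using (Subset; ∣_∣) renaming (_∈_ to _∈ₛ_)
import Data.Integer as ℤ
import Data.Integer.Properties as ℤ
open import Data.List using (List; []; _∷_; _++_; allFin; filter; length; map; replicate)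
import Data.List as List
open import Data.List.Membership.Propositional using (_∈_; lose)
open import Data.List.Membership.Propositional.Properties using (∈-allFin)
open import Data.List.Properties using (map-tabulate; tabulate-cong)
open import Data.List.Relation.Unary.All as All using (All; []; _∷_)
open import Data.List.Relation.Unary.AllPairs using ([]; _∷_)
open import Data.List.Relation.Unary.Any using (here; there; satisfied)
open import Data.List.Relation.Unary.Any.Properties using (any⁺; any⁻; singleton⁻)
open import Data.List.Relation.Unary.Unique.Propositional using (Unique)
open import Data.Nat using (zero; suc; pred; _<_; _≡ᵇ_; _<ᵇ_; _≤?_; _<?_; _≟_; z≤n; s≤s; s≤s⁻¹; z<s; s<s; >-nonZero)
open import Data.Nat.ListAction using (sum)
open import Data.Nat.ListAction.Properties using (sum-++)
open import Data.Nat.Properties hiding (_≟_)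
open import Algebra.Properties.CommutativeMonoid.Sum +-0-commutativeMonoid
  using (∑-comm; ∑-distrib-+; sum-cong-≗) renaming (sum to ∑)
open import Algebra.Properties.CommutativeSemigroup +-commutativeSemigroup using (interchange)
import Data.List.Sort.InsertionSort.Base ≤-decTotalOrder as Sorting
open import Data.Nat.Tactic.RingSolver using (solve-∀)
open import Data.Product using (_,_; proj₁; proj₂)
open import Data.Sum using (_⊎_; inj₁; inj₂; swap)
open import Data.Vec using (Vec; []; _∷_; lookup; tabulate)
open import Data.Vec.Properties using ([]=⇒lookup; lookup⇒[]=; lookup∘tabulate)
open import Function using (_∘_; case_of_; Equivalence)
open import Relation.Binary using (tri<; tri≈; tri>)
open import Relation.Binary.PropositionalEquality
open import Relation.Nullary using (yes; no; ¬_)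
open import Relation.Nullary.Decidable using (_×-dec_)
open Equivalence

≡ᵇ-true⇒≡ : ∀ {m n} → (m ≡ᵇ n) ≡ true → m ≡ n
≡ᵇ-true⇒≡ {m} {n} eq = ≡ᵇ⇒≡ m n (T-≡ .from eq)

≡⇒≡ᵇ-true : ∀ {m n} → m ≡ n → (m ≡ᵇ n) ≡ true
≡⇒≡ᵇ-true {m} {n} m≡n = T-≡ .to (≡⇒≡ᵇ m n m≡n)

≢⇒≡ᵇ-false : ∀ {m n} → m ≢ n → (m ≡ᵇ n) ≡ false
≢⇒≡ᵇ-false m≢n = ¬-not (m≢n ∘ ≡ᵇ-true⇒≡)

<⇒<ᵇ-true : ∀ {m n} → m < n → (m <ᵇ n) ≡ true
<⇒<ᵇ-true m<n = T-≡ .to (<⇒<ᵇ m<n)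

≤⇒<ᵇ-false : ∀ {m n} → n ≤ m → (m <ᵇ n) ≡ false
≤⇒<ᵇ-false {m} {n} n≤m = ¬-not (λ m<ᵇn → <⇒≱ (<ᵇ⇒< m n (T-≡ .from m<ᵇn)) n≤m)

≡ᵇ-+⇒≡ : ∀ {m n} c → T (m ≡ᵇ n + suc c) → m ≡ suc c + n
≡ᵇ-+⇒≡ {m} {n} c t = trans (≡ᵇ⇒≡ _ _ t) (+-comm n (suc c))

≡⇒≡ᵇ-+ : ∀ {m n} c → m ≡ suc c + n → T (m ≡ᵇ n + suc c)
≡⇒≡ᵇ-+ {m} {n} c e = ≡⇒≡ᵇ _ _ (trans e (+-comm (suc c) n))

∨-elim : ∀ x {y} → T (x ∨ y) → T x ⊎ T y
∨-elim x = T-∨ {x} .to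

∨-introʳ : ∀ x {y} → T y → T (x ∨ y)
∨-introʳ x t = T-∨ {x} .from (inj₂ t)

∨-introˡ : ∀ {x} y → T x → T (x ∨ y)
∨-introˡ y t = T-∨ {y = y} .from (inj₁ t)

∧-elim : ∀ x {y} → T (x ∧ y) → T x × T y
∧-elim x = T-∧ {x} .to

∧-intro : ∀ {x y} → T x → T y → T (x ∧ y)
∧-intro a b = T-∧ .from (a , b)

≡true⇒≢false : ∀ {b} → b ≡ true → b ≢ false
≡true⇒≢false refl ()

no-counterexample⇒implies : ∀ {a b} → ¬ (a ≡ false × b ≡ true) → b ≡ true → a ≡ true
no-counterexample⇒implies {true} _ _ = refl
no-counterexample⇒implies {false} ¬c b = ⊥-elim (¬c (refl , b))

-- Counting on initial segments of ℕ

χ : Bool → ℕ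
χ true = 1
χ false = 0

χ≤1 : ∀ b → χ b ≤ 1
χ≤1 true = ≤-refl
χ≤1 false = z≤n

χ-mono : ∀ {a b} → (a ≡ true → b ≡ true) → χ a ≤ χ b
χ-mono {false} a⇒b = z≤n
χ-mono {true} a⇒b rewrite a⇒b refl = ≤-refl

χ-∨-∧ : ∀ a b → χ a + χ b ≡ χ (a ∨ b) + χ (a ∧ b)
χ-∨-∧ true true = refl
χ-∨-∧ true false = refl
χ-∨-∧ false b = sym (+-identityʳ (χ b))

count : (ℕ → Bool) → ℕ → ℕ
count f zero = 0
count f (suc n) = χ (f 0) + count (f ∘ suc) n

count-last : ∀ f n → count f (suc n) ≡ count f n + χ (f n)
count-last f zero = +-comm (χ (f 0)) 0
count-last f (suc n) = trans (cong (χ (f 0) +_) (count-last (f ∘ suc) n))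
                             (sym (+-assoc (χ (f 0)) _ _))

count-split : ∀ f m l → count f (m + l) ≡ count f m + count (f ∘ (m +_)) l
count-split f zero l = refl
count-split f (suc m) l = trans (cong (χ (f 0) +_) (count-split (f ∘ suc) m l))
                                (sym (+-assoc (χ (f 0)) _ _))

count-≤ : ∀ f n → count f n ≤ n
count-≤ f zero = z≤n
count-≤ f (suc n) = +-mono-≤ (χ≤1 (f 0)) (count-≤ (f ∘ suc) n)

count-true : ∀ n → count (λ _ → true) n ≡ n
count-true zero = refl
count-true (suc n) = cong suc (count-true n)

count-cong : ∀ {f g} n → (∀ {i} → i < n → f i ≡ g i) → count f n ≡ count g n
count-cong zero f≗g = refl
count-cong (suc n) f≗g = cong₂ _+_ (cong χ (f≗g z<s)) (count-cong n (f≗g ∘ s<s))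

count-mono : ∀ {f g} n → (∀ {i} → i < n → f i ≡ true → g i ≡ true) → count f n ≤ count g n
count-mono zero f⇒g = z≤n
count-mono (suc n) f⇒g = +-mono-≤ (χ-mono (f⇒g z<s)) (count-mono n (f⇒g ∘ s<s))

count-mono-< : ∀ {f g} n → (∀ {i} → i < n → f i ≡ true → g i ≡ true) →
               ∀ {j} → j < n → f j ≡ false → g j ≡ true → count f n < count g n
count-mono-< {f} {g} (suc n) f⇒g {zero} _ fj gj rewrite fj | gj =
  s≤s (count-mono n (f⇒g ∘ s<s))
count-mono-< {f} {g} (suc n) f⇒g {suc j} (s<s j<n) fj gj =
  +-mono-≤-< (χ-mono (f⇒g z<s)) (count-mono-< n (f⇒g ∘ s<s) j<n fj gj)

count-none : ∀ {f} n → (∀ {i} → i < n → f i ≡ false) → count f n ≡ 0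
count-none zero _ = refl
count-none {f} (suc n) f≡false rewrite f≡false z<s = count-none n (f≡false ∘ s<s)

count-∨-∧ : ∀ f g n → count f n + count g n ≡ count (λ i → f i ∨ g i) n + count (λ i → f i ∧ g i) n
count-∨-∧ f g zero = refl
count-∨-∧ f g (suc n) = begin
  (χ f₀ + count (f ∘ suc) n) + (χ g₀ + count (g ∘ suc) n)  ≡⟨ interchange (χ f₀) _ _ _ ⟩
  (χ f₀ + χ g₀) + (count (f ∘ suc) n + count (g ∘ suc) n)  ≡⟨ cong₂ _+_ (χ-∨-∧ f₀ g₀) (count-∨-∧ (f ∘ suc) (g ∘ suc) n) ⟩
  (χ (f₀ ∨ g₀) + χ (f₀ ∧ g₀)) + (count _ n + count _ n)    ≡⟨ interchange (χ (f₀ ∨ g₀)) _ _ _ ⟩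
  (χ (f₀ ∨ g₀) + count _ n) + (χ (f₀ ∧ g₀) + count _ n)    ∎
  where
  open ≡-Reasoning
  f₀ = f 0
  g₀ = g 0

count-∨-disjoint : ∀ {f g} n → (∀ {i} → i < n → f i ∧ g i ≡ false) →
                   count (λ i → f i ∨ g i) n ≡ count f n + count g n
count-∨-disjoint {f} {g} n disjoint = begin
  count (λ i → f i ∨ g i) n                                   ≡⟨ +-identityʳ _ ⟨
  count (λ i → f i ∨ g i) n + 0                               ≡⟨ cong (count _ n +_) (count-none n disjoint) ⟨
  count (λ i → f i ∨ g i) n + count (λ i → f i ∧ g i) n       ≡⟨ count-∨-∧ f g n ⟨
  count f n + count g n                                       ∎
  where open ≡-Reasoning

count-point : ∀ {x} n → x < n → count (_≡ᵇ x) n ≡ 1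
count-point {zero} (suc n) _ = cong suc (count-none n (λ _ → refl))
count-point {suc x} (suc n) (s<s x<n) = count-point n x<n

count-∈ : ∀ {f} n (L : List ℕ) → Unique L → All (_< n) L →
          (∀ {i} → i < n → f i ≡ true → i ∈ L) → (∀ {i} → i ∈ L → f i ≡ true) →
          count f n ≡ length L
count-∈ n [] _ _ sound _ = count-none n (λ i<n → ¬-not (λ fi → case sound i<n fi of λ ()))
count-∈ {f} n (x ∷ L) (x∉L ∷ unique) (x<n ∷ L<n) sound complete = begin
  count f n                                  ≡⟨ count-cong n (λ {i} _ → split i) ⟩
  count (λ i → (i ≡ᵇ x) ∨ rest i) n          ≡⟨ count-∨-disjoint n (λ {i} _ → disjoint i) ⟩
  count (_≡ᵇ x) n + count rest n             ≡⟨ cong₂ _+_ (count-point n x<n) (count-∈ n L unique L<n sound′ complete′) ⟩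
  suc (length L)                             ∎
  where
  open ≡-Reasoning
  rest : ℕ → Bool
  rest i = f i ∧ not (i ≡ᵇ x)
  split : ∀ i → f i ≡ (i ≡ᵇ x) ∨ rest i
  split i with i ≡ᵇ x in eq
  ... | true = complete (here (≡ᵇ-true⇒≡ eq))
  ... | false = sym (∧-identityʳ (f i))
  disjoint : ∀ i → ((i ≡ᵇ x) ∧ rest i) ≡ false
  disjoint i with i ≡ᵇ x
  ... | true = ∧-zeroʳ (f i)
  ... | false = refl
  sound′ : ∀ {i} → i < n → rest i ≡ true → i ∈ L
  sound′ {i} i<n resti with sound i<n (∧-conicalˡ _ _ resti)
  ... | here i≡x = case trans (sym (cong not (≡⇒≡ᵇ-true i≡x))) (∧-conicalʳ (f i) _ resti) of λ ()
  ... | there i∈L = i∈L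
  complete′ : ∀ {i} → i ∈ L → rest i ≡ true
  complete′ {i} i∈L rewrite complete (there i∈L) | ≢⇒≡ᵇ-false (All.lookup x∉L i∈L ∘ sym) = refl

count-last₃ : ∀ f m → count f (3 + m) ≡ count f m + (χ (f m) + χ (f (1 + m)) + χ (f (2 + m)))
count-last₃ f m = begin
  count f (3 + m)                                                  ≡⟨ count-last f (2 + m) ⟩
  count f (2 + m) + χ (f (2 + m))                                  ≡⟨ cong (_+ χ (f (2 + m))) (count-last f (1 + m)) ⟩
  count f (1 + m) + χ (f (1 + m)) + χ (f (2 + m))
    ≡⟨ cong (λ c → c + χ (f (1 + m)) + χ (f (2 + m))) (count-last f m) ⟩
  count f m + χ (f m) + χ (f (1 + m)) + χ (f (2 + m))              ≡⟨ cong (_+ χ (f (2 + m))) (+-assoc (count f m) _ _) ⟩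
  count f m + (χ (f m) + χ (f (1 + m))) + χ (f (2 + m))            ≡⟨ +-assoc (count f m) _ _ ⟩
  count f m + (χ (f m) + χ (f (1 + m)) + χ (f (2 + m)))            ∎
  where open ≡-Reasoning

count-disjoint : ∀ {f g} n → (∀ {i} → i < n → f i ∧ g i ≡ false) → count f n + count g n ≤ n
count-disjoint {f} {g} n disjoint = begin
  count f n + count g n          ≡⟨ count-∨-disjoint n disjoint ⟨
  count (λ i → f i ∨ g i) n      ≤⟨ count-≤ _ n ⟩
  n                              ∎
  where open ≤-Reasoning

count-complement : ∀ f n → count f n + count (not ∘ f) n ≡ n
count-complement f n = begin
  count f n + count (not ∘ f) n       ≡⟨ count-∨-disjoint n (λ {i} _ → ∧-inverseʳ (f i)) ⟨
  count (λ i → f i ∨ not (f i)) n     ≡⟨ count-cong n (λ {i} _ → ∨-inverseʳ (f i)) ⟩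
  count (λ _ → true) n                ≡⟨ count-true n ⟩
  n                                   ∎
  where open ≡-Reasoning

m+m≡n+n⇒m≡n : ∀ {m n} → m + m ≡ n + n → m ≡ n
m+m≡n+n⇒m≡n {m} {n} eq with <-cmp m n
... | tri< m<n _ _ = ⊥-elim (<⇒≢ (+-mono-< m<n m<n) eq)
... | tri≈ _ m≡n _ = m≡n
... | tri> _ _ n<m = ⊥-elim (>⇒≢ (+-mono-< n<m n<m) eq)

m-n≤o-p : ∀ {m n o p} → m + p ≤ o + n → ℤ.+ m ℤ.- ℤ.+ n ℤ.≤ ℤ.+ o ℤ.- ℤ.+ p
m-n≤o-p {m} {n} {o} {p} m+p≤o+n rewrite ℤ.[+m]-[+n]≡m⊖n m n | ℤ.[+m]-[+n]≡m⊖n o p =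
  subst₂ ℤ._≤_ (ℤ.+-cancelˡ-⊖ p m n) (trans (cong₂ ℤ._⊖_ (+-comm o n) (+-comm p n)) (ℤ.+-cancelˡ-⊖ n o p))
    (ℤ.⊖-monoˡ-≤ (p + n) (subst (_≤ o + n) (+-comm m p) m+p≤o+n))

m-n<o-p : ∀ {m n o p} → m + p < o + n → ℤ.+ m ℤ.- ℤ.+ n ℤ.< ℤ.+ o ℤ.- ℤ.+ p
m-n<o-p {m} {n} {o} {p} m+p<o+n rewrite ℤ.[+m]-[+n]≡m⊖n m n | ℤ.[+m]-[+n]≡m⊖n o p =
  subst₂ ℤ._<_ (ℤ.+-cancelˡ-⊖ p m n) (trans (cong₂ ℤ._⊖_ (+-comm o n) (+-comm p n)) (ℤ.+-cancelˡ-⊖ n o p))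
    (ℤ.⊖-monoˡ-< (p + n) (subst (_< o + n) (+-comm m p) m+p<o+n))

tabulate-replicate : ∀ {A : Set} m {l} (g : ℕ → A) {c} → (∀ {i} → i < m → g i ≡ c) →
                     List.tabulate {n = m + l} (g ∘ toℕ) ≡ replicate m c ++ List.tabulate {n = l} (g ∘ (m +_) ∘ toℕ)
tabulate-replicate zero g _ = refl
tabulate-replicate (suc m) g g≡c = cong₂ _∷_ (g≡c z<s) (tabulate-replicate m (g ∘ suc) (g≡c ∘ s<s))

sum-replicate : ∀ m c → sum (replicate m c) ≡ m * c
sum-replicate zero c = refl
sum-replicate (suc m) c = cong (c +_) (sum-replicate m c)

sum-take-replicate : ∀ {j m} c → j ≤ m → sum (List.take j (replicate m c)) ≡ j * c
sum-take-replicate {zero} c _ = refl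
sum-take-replicate {suc j} {suc m} c (s≤s j≤m) = cong (c +_) (sum-take-replicate c j≤m)

insert-3 : ∀ m → Sorting.insert 3 (replicate m 3) ≡ replicate (suc m) 3
insert-3 zero = refl
insert-3 (suc m) = refl

sort-degree-sequence : ∀ m → Sorting.sort (replicate m 3 ++ 1 ∷ 1 ∷ []) ≡ 1 ∷ 1 ∷ replicate m 3
sort-degree-sequence zero = refl
sort-degree-sequence (suc m) rewrite sort-degree-sequence m | insert-3 m = refl

unique₃ : ∀ {a b c : ℕ} → a ≢ b → a ≢ c → b ≢ c → Unique (a ∷ b ∷ c ∷ [])
unique₃ a≢b a≢c b≢c = (a≢b ∷ a≢c ∷ []) ∷ (b≢c ∷ []) ∷ [] ∷ []

-- Odd cycles and stars

module RotationByTwo {K h : ℕ} (K≡2[1+h] : K ≡ 2 * suc h) (s : ℕ → Bool) where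

  P : ℕ
  P = suc (2 * h)

  K≡2+P : K ≡ suc P
  K≡2+P = trans K≡2[1+h] (*-suc 2 h)

  -- 0 … K is an odd cycle; wrap-P and wrap-K are the steps P ↦ 0 and K ↦ 1 of rotation by two.
  module _ (+2-closed : ∀ {j} → suc (suc j) ≤ K → s j ≡ true → s (suc (suc j)) ≡ true)
           (wrap-P : s P ≡ true → s 0 ≡ true)
           (wrap-K : s K ≡ true → s 1 ≡ true) where

    chain : ∀ d {j} → 2 * d + j ≤ K → s j ≡ true → s (2 * d + j) ≡ true
    chain zero _ sj = sj
    chain (suc d) {j} le sj = subst (λ i → s i ≡ true) (sym two-more)
      (+2-closed (subst (_≤ K) two-more le) (chain d (m+n≤o⇒n≤o 2 (subst (_≤ K) two-more le)) sj))
      where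
      two-more : 2 * suc d + j ≡ suc (suc (2 * d + j))
      two-more = cong (_+ j) (*-suc 2 d)

    from-K : s K ≡ true → s 0 ≡ true × s 1 ≡ true
    from-K sK = wrap-P (subst (λ i → s i ≡ true) (+-comm (2 * h) 1) (chain h 2h+1≤K s1)) , s1
      where
      s1 = wrap-K sK
      2h+1≤K : 2 * h + 1 ≤ K
      2h+1≤K = ≤-trans (≤-reflexive (+-comm (2 * h) 1)) (≤-trans (n≤1+n P) (≤-reflexive (sym K≡2+P)))

    from-P : s P ≡ true → s 0 ≡ true × s 1 ≡ true
    from-P sP = from-K (subst (λ i → s i ≡ true) 2[1+h]+0≡K (chain (suc h) (≤-reflexive 2[1+h]+0≡K) (wrap-P sP)))
      where
      2[1+h]+0≡K : 2 * suc h + 0 ≡ K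
      2[1+h]+0≡K = trans (+-identityʳ _) (sym K≡2[1+h])

    climb : ∀ r {j} → r + j ≡ K → s j ≡ true → s P ≡ true ⊎ s K ≡ true
    climb zero refl sj = inj₂ sj
    climb (suc zero) {j} e sj = inj₁ (subst (λ i → s i ≡ true) (suc-injective (trans e K≡2+P)) sj)
    climb (suc (suc r)) {j} e sj =
      climb r (trans (+-suc r (suc j)) (trans (cong suc (+-suc r j)) e))
              (+2-closed (≤-trans (s≤s (s≤s (m≤n+m j r))) (≤-reflexive e)) sj)

    contains-0-and-1 : ∀ {j} → j ≤ K → s j ≡ true → s 0 ≡ true × s 1 ≡ true
    contains-0-and-1 {j} j≤K sj with climb (K ∸ j) (m∸n+n≡m j≤K) sj
    ... | inj₁ sP = from-P sP
    ... | inj₂ sK = from-K sK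

module Surplus {K h : ℕ} (K≡2[1+h] : K ≡ 2 * suc h) {s t : ℕ → Bool} where
  open RotationByTwo K≡2[1+h] s using (P; K≡2+P; contains-0-and-1)

  module _ (not-both-0-1 : s 0 ≡ true → s 1 ≡ true → ⊥)
           (nbhd-suc : ∀ {i} → i < K → s i ≡ true → t (suc i) ≡ true)
           (nbhd-pred : ∀ {i} → i < K → s (suc i) ≡ true → t i ≡ true)
           (nbhd-K : s 0 ≡ true → t K ≡ true)
           (nbhd-0 : s K ≡ true → t 0 ≡ true) where

    surplus : ∀ {j} → j ≤ K → s j ≡ true → suc (count s (suc K)) ≤ count t (suc K)
    surplus {j} j≤K sj = subst (suc (count s (suc K)) ≤_) (sym count-t) strict
      where
      count-t : count t (suc K) ≡ χ (t K) + count t K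
      count-t = trans (count-last t K) (+-comm (count t K) _)
      -- s shifted one step back lies in t. If that shift misses no point of t, then t lies in the
      -- shift, which makes s closed under rotation by two.
      strict : suc (χ (s 0) + count (s ∘ suc) K) ≤ χ (t K) + count t K
      strict with anyUpTo? (λ i → (s (suc i) Bool.≟ false) ×-dec (t i Bool.≟ true)) K
      ... | yes (i , i<K , s[1+i]≡false , ti≡true) =
        +-mono-≤-< (χ-mono nbhd-K) (count-mono-< K nbhd-pred i<K s[1+i]≡false ti≡true)
      ... | no ¬shift-strict with (s 0 Bool.≟ false) ×-dec (t K Bool.≟ true)
      ... | yes (s0≡false , tK≡true) rewrite s0≡false | tK≡true = s≤s (count-mono K nbhd-pred)
      ... | no ¬wrap-strict = ⊥-elim (not-both-0-1 s0 s1)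
        where
        back : ∀ {i} → i < K → t i ≡ true → s (suc i) ≡ true
        back i<K = no-counterexample⇒implies (λ c → ¬shift-strict (_ , i<K , c))
        +2-closed : ∀ {i} → suc (suc i) ≤ K → s i ≡ true → s (suc (suc i)) ≡ true
        +2-closed 2+i≤K si = back 2+i≤K (nbhd-suc (<-trans (n<1+n _) 2+i≤K) si)
        wrap-P : s P ≡ true → s 0 ≡ true
        wrap-P sP = no-counterexample⇒implies ¬wrap-strict
          (subst (λ i → t i ≡ true) (sym K≡2+P) (nbhd-suc (≤-reflexive (sym K≡2+P)) sP))
        wrap-K : s K ≡ true → s 1 ≡ true
        wrap-K sK = back (subst (0 <_) (sym K≡2+P) z<s) (nbhd-0 sK)
        s0 = proj₁ (contains-0-and-1 +2-closed wrap-P wrap-K j≤K sj)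
        s1 = proj₂ (contains-0-and-1 +2-closed wrap-P wrap-K j≤K sj)

star-bounds : ∀ {sy sx₁ sx₂ ty tx₁ tx₂ : Bool} →
              (sy ≡ true → sx₁ ≡ false × sx₂ ≡ false × tx₁ ≡ true × tx₂ ≡ true) →
              (sx₁ ≡ true → ty ≡ true) → (sx₂ ≡ true → ty ≡ true) →
              χ sy + χ sx₁ + χ sx₂ ≤ 2 × χ sy + χ sx₁ + χ sx₂ ≤ suc (χ ty + χ tx₁ + χ tx₂)
star-bounds {true} y-excludes _ _ with y-excludes refl
... | refl , refl , refl , refl = s≤s z≤n , s≤s z≤n
star-bounds {false} {false} {false} _ _ _ = z≤n , z≤n
star-bounds {false} {true} {sx₂} {ty} _ x₁⇒y _ rewrite x₁⇒y refl = s≤s (χ≤1 sx₂) , s≤s (≤-trans (χ≤1 sx₂) (s≤s z≤n))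
star-bounds {false} {false} {true} {ty} _ _ x₂⇒y rewrite x₂⇒y refl = s≤s z≤n , s≤s z≤n

-- Graphs on Fin n

∑-χ≡count : ∀ {n} (f : ℕ → Bool) → ∑ (λ (i : Fin n) → χ (f (toℕ i))) ≡ count f n
∑-χ≡count {zero} f = refl
∑-χ≡count {suc n} f = cong (χ (f 0) +_) (∑-χ≡count {n} (f ∘ suc))

length-filter≡∑ : ∀ {A : Set} {n} (p : A → Bool) (h : Fin n → A) →
                  length (filter (T? ∘ p) (List.tabulate h)) ≡ ∑ (χ ∘ p ∘ h)
length-filter≡∑ {n = zero} p h = refl
length-filter≡∑ {n = suc n} p h with p (h fzero)
... | true = cong suc (length-filter≡∑ p (h ∘ fsuc))
... | false = length-filter≡∑ p (h ∘ fsuc)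

sum-map≡∑ : ∀ {A : Set} {n} (g : A → ℕ) (h : Fin n → A) → sum (map g (List.tabulate h)) ≡ ∑ (g ∘ h)
sum-map≡∑ {n = zero} g h = refl
sum-map≡∑ {n = suc n} g h = cong (g (h fzero) +_) (sum-map≡∑ g (h ∘ fsuc))

module _ {n} (H : Graph n) where

  private
    up : Fin n → Fin n → Bool
    up u v = (toℕ u <ᵇ toℕ v) ∧ Adj H u v

  degree≡∑ : ∀ u → degree H u ≡ ∑ (χ ∘ Adj H u)
  degree≡∑ u = length-filter≡∑ (Adj H u) (λ v → v)

  numEdges≡∑∑ : numEdges H ≡ ∑ (λ u → ∑ (χ ∘ up u))
  numEdges≡∑∑ = trans (sum-map≡∑ {n = n} _ (λ u → u)) (sum-cong-≗ (λ u → length-filter≡∑ (up u) (λ v → v)))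

  χ-Adj≡χ-up+χ-up : ∀ u v → χ (Adj H u v) ≡ χ (up u v) + χ (up v u)
  χ-Adj≡χ-up+χ-up u v with <-cmp (toℕ u) (toℕ v)
  ... | tri< u<v _ _ rewrite <⇒<ᵇ-true u<v | ≤⇒<ᵇ-false (<⇒≤ u<v) = sym (+-identityʳ _)
  ... | tri≈ _ u≡v _ rewrite toℕ-injective u≡v | irrefl H v | ≤⇒<ᵇ-false (≤-refl {toℕ v}) = refl
  ... | tri> _ _ v<u rewrite <⇒<ᵇ-true v<u | ≤⇒<ᵇ-false (<⇒≤ v<u) | Graph.sym H v u = refl

  handshake : sum (map (degree H) (allFin n)) ≡ numEdges H + numEdges H
  handshake = begin
    sum (map (degree H) (allFin n))                     ≡⟨ sum-map≡∑ (degree H) (λ u → u) ⟩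
    ∑ (λ u → degree H u)                                ≡⟨ sum-cong-≗ degree≡∑ ⟩
    ∑ (λ u → ∑ (λ v → χ (Adj H u v)))                   ≡⟨ sum-cong-≗ (λ u → sum-cong-≗ (χ-Adj≡χ-up+χ-up u)) ⟩
    ∑ (λ u → ∑ (λ v → χ (up u v) + χ (up v u)))         ≡⟨ sum-cong-≗ (λ u → ∑-distrib-+ (χ ∘ up u) (λ v → χ (up v u))) ⟩
    ∑ (λ u → ∑ (χ ∘ up u) + ∑ (λ v → χ (up v u)))       ≡⟨ ∑-distrib-+ (λ u → ∑ (χ ∘ up u)) _ ⟩
    ∑ (λ u → ∑ (χ ∘ up u)) + ∑ (λ u → ∑ (λ v → χ (up v u)))
                                                        ≡⟨ cong (∑ (λ u → ∑ (χ ∘ up u)) +_) (∑-comm (λ u v → χ (up v u))) ⟩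
    ∑ (λ u → ∑ (χ ∘ up u)) + ∑ (λ v → ∑ (χ ∘ up v))     ≡⟨ cong₂ _+_ (sym numEdges≡∑∑) (sym numEdges≡∑∑) ⟩
    numEdges H + numEdges H                             ∎
    where open ≡-Reasoning

at : ∀ {n} → Vec Bool n → ℕ → Bool
at [] _ = false
at (b ∷ S) zero = b
at (b ∷ S) (suc i) = at S i

lookup≡at : ∀ {n} (S : Vec Bool n) v → lookup S v ≡ at S (toℕ v)
lookup≡at (b ∷ S) fzero = refl
lookup≡at (b ∷ S) (fsuc v) = lookup≡at S v

at-true⇒< : ∀ {n} (S : Vec Bool n) {i} → at S i ≡ true → i < n
at-true⇒< (b ∷ S) {zero} _ = z<s
at-true⇒< (b ∷ S) {suc i} Si = s<s (at-true⇒< S Si)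

∣∣≡count : ∀ {n} (S : Subset n) → ∣ S ∣ ≡ count (at S) n
∣∣≡count [] = refl
∣∣≡count (true ∷ S) = cong suc (∣∣≡count S)
∣∣≡count (false ∷ S) = ∣∣≡count S

at-tabulate : ∀ {n} (f : ℕ → Bool) {i} → i < n → at (tabulate {n = n} (f ∘ toℕ)) i ≡ f i
at-tabulate {suc n} f {zero} _ = refl
at-tabulate {suc n} f {suc i} (s<s i<n) = at-tabulate (f ∘ suc) i<n

∈ₛ⇒at : ∀ {n} {S : Subset n} {v} → v ∈ₛ S → at S (toℕ v) ≡ true
∈ₛ⇒at {S = S} {v} v∈S = trans (sym (lookup≡at S v)) ([]=⇒lookup v∈S)

at⇒∈ₛ : ∀ {n} {S : Subset n} {v} → at S (toℕ v) ≡ true → v ∈ₛ S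
at⇒∈ₛ {S = S} {v} Sv = lookup⇒[]= v S (trans (lookup≡at S v) Sv)

Reach-trans : ∀ {n} {H : Graph n} {u v w} → Reach H u v → Reach H v w → Reach H u w
Reach-trans u⇝v here = u⇝v
Reach-trans u⇝v (step v⇝w w~x) = step (Reach-trans u⇝v v⇝w) w~x

Reach-sym : ∀ {n} {H : Graph n} {u v} → Reach H u v → Reach H v u
Reach-sym here = here
Reach-sym {H = H} (step {v} {w} u⇝v v~w) = Reach-trans (step here (trans (Graph.sym H w v) v~w)) (Reach-sym u⇝v)

connected-from-root : ∀ {n} (H : Graph n) r → (∀ v → Reach H r v) → Connected H
connected-from-root H r r⇝ u v = Reach-trans (Reach-sym (r⇝ u)) (r⇝ v)

module ℕAdjacency {n} (H : Graph n) (adj : ℕ → ℕ → Bool)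
                    (Adj≡adj : ∀ u v → Adj H u v ≡ adj (toℕ u) (toℕ v)) where

  vertex : ∀ {i} → i < n → Fin n
  vertex i<n = fromℕ< i<n

  Adj-vertex : ∀ {i j} (i<n : i < n) (j<n : j < n) → Adj H (vertex i<n) (vertex j<n) ≡ adj i j
  Adj-vertex i<n j<n = trans (Adj≡adj _ _) (cong₂ adj (toℕ-fromℕ< i<n) (toℕ-fromℕ< j<n))

  at-vertex : ∀ (S : Subset n) {i} (i<n : i < n) → at S (toℕ (vertex i<n)) ≡ at S i
  at-vertex S i<n = cong (at S) (toℕ-fromℕ< i<n)

  independent⇒adj-false : ∀ {S} → Independent H S → ∀ {i j} → at S i ≡ true → at S j ≡ true → adj i j ≡ false
  independent⇒adj-false {S} indep Si Sj =
    trans (sym (Adj-vertex i<n j<n))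
          (indep _ _ (at⇒∈ₛ (trans (at-vertex S i<n) Si)) (at⇒∈ₛ (trans (at-vertex S j<n) Sj)))
    where
    i<n = at-true⇒< S Si
    j<n = at-true⇒< S Sj

  adj-false⇒independent : ∀ {S} → (∀ {i j} → at S i ≡ true → at S j ≡ true → adj i j ≡ false) → Independent H S
  adj-false⇒independent no-edge u v u∈S v∈S = trans (Adj≡adj u v) (no-edge (∈ₛ⇒at u∈S) (∈ₛ⇒at v∈S))

  at-Nbhd : ∀ S {j} (j<n : j < n) → at (Nbhd H S) j ≡ any (λ u → lookup S u ∧ Adj H u (vertex j<n)) (allFin n)
  at-Nbhd S j<n = trans (sym (at-vertex (Nbhd H S) j<n))
                        (trans (sym (lookup≡at (Nbhd H S) (vertex j<n))) (lookup∘tabulate _ (vertex j<n)))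

  Nbhd-intro : ∀ S {i j} → at S i ≡ true → adj i j ≡ true → j < n → at (Nbhd H S) j ≡ true
  Nbhd-intro S {i} Si adj-ij j<n = trans (at-Nbhd S j<n) (T-≡ .to (any⁺ _ (lose (∈-allFin (vertex i<n)) (T-≡ .from edge))))
    where
    i<n = at-true⇒< S Si
    edge : (lookup S (vertex i<n) ∧ Adj H (vertex i<n) (vertex j<n)) ≡ true
    edge = cong₂ _∧_ (trans (lookup≡at S (vertex i<n)) (trans (at-vertex S i<n) Si)) (trans (Adj-vertex i<n j<n) adj-ij)

  Nbhd-elim : ∀ S {j} → at (Nbhd H S) j ≡ true → ∃ λ i → at S i ≡ true × adj i j ≡ true
  Nbhd-elim S {j} Nj = toℕ u , trans (sym (lookup≡at S u)) (∧-conicalˡ _ _ Su∧u~j)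
                             , trans (sym Adj-u-j) (∧-conicalʳ _ _ Su∧u~j)
    where
    j<n = at-true⇒< (Nbhd H S) Nj
    witness = satisfied (any⁻ _ (allFin n) (T-≡ .from (trans (sym (at-Nbhd S j<n)) Nj)))
    u = proj₁ witness
    Su∧u~j : (lookup S u ∧ Adj H u (vertex j<n)) ≡ true
    Su∧u~j = T-≡ .to (proj₂ witness)
    Adj-u-j : Adj H u (vertex j<n) ≡ adj (toℕ u) j
    Adj-u-j = trans (Adj≡adj u _) (cong (adj (toℕ u)) (toℕ-fromℕ< j<n))

  degree≡count : ∀ v → degree H v ≡ count (adj (toℕ v)) n
  degree≡count v = trans (degree≡∑ H v) (trans (sum-cong-≗ (cong χ ∘ Adj≡adj v)) (∑-χ≡count {n} (adj (toℕ v))))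

  Reach-step : ∀ {r i j} (i<n : i < n) (j<n : j < n) → Reach H r (vertex i<n) → adj i j ≡ true → Reach H r (vertex j<n)
  Reach-step i<n j<n r⇝i i~j = step r⇝i (trans (Adj-vertex i<n j<n) i~j)

  Reach-all : ∀ {r} → (∀ {i} (i<n : i < n) → Reach H r (vertex i<n)) → ∀ v → Reach H r v
  Reach-all {r} r⇝ v = subst (Reach H r) (fromℕ<-toℕ v (toℕ<n v)) (r⇝ (toℕ<n v))

  module _ {S} (indep : Independent H S) where

    Nbhd-disjoint : ∀ i → at S i ∧ at (Nbhd H S) i ≡ false
    Nbhd-disjoint i with at S i in Si | at (Nbhd H S) i in Ni
    ... | false | _ = refl
    ... | true | false = refl
    ... | true | true with Nbhd-elim S Ni
    ...   | j , Sj , j~i = case trans (sym j~i) (independent⇒adj-false indep Sj Si) of λ ()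

-- The graph G_k

adj : ℕ → ℕ → ℕ → Bool
adj k i j = not (i ≡ᵇ j) ∧ (baseEdge k i j ∨ baseEdge k j i)

module Gℕ (k : ℕ) = ℕAdjacency (G k) (adj k) (λ _ _ → refl)

data Arc (k i j : ℕ) : Set where
  path  : j ≡ suc i → i < 2 * k → Arc k i j
  close : i ≡ 0 → j ≡ 2 * k → Arc k i j
  chord : i < k → j ≡ i + k → Arc k i j
  spoke : i ≡ 2 * k → j ≡ 1 + 2 * k → Arc k i j
  leaf₁ : i ≡ 1 + 2 * k → j ≡ 2 + 2 * k → Arc k i j
  leaf₂ : i ≡ 1 + 2 * k → j ≡ 3 + 2 * k → Arc k i j

Edge : ℕ → ℕ → ℕ → Set
Edge k i j = Arc k i j ⊎ Arc k j i

-- The first five disjuncts of baseEdge, named because ∨-elim needs its left operand.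
pathᵇ closeᵇ chordᵇ spokeᵇ leaf₁ᵇ : ℕ → ℕ → ℕ → Bool
pathᵇ k i j = (j ≡ᵇ suc i) ∧ (i <ᵇ 2 * k)
closeᵇ k i j = (i ≡ᵇ 0) ∧ (j ≡ᵇ 2 * k)
chordᵇ k i j = (i <ᵇ k) ∧ (j ≡ᵇ i + k)
spokeᵇ k i j = (i ≡ᵇ 2 * k) ∧ (j ≡ᵇ 2 * k + 1)
leaf₁ᵇ k i j = (i ≡ᵇ 2 * k + 1) ∧ (j ≡ᵇ 2 * k + 2)

baseEdge⇒Arc : ∀ k i j → T (baseEdge k i j) → Arc k i j
baseEdge⇒Arc k i j t with ∨-elim (pathᵇ k i j) t
... | inj₁ t₁ = let a , b = ∧-elim (j ≡ᵇ suc i) t₁ in path (≡ᵇ⇒≡ _ _ a) (<ᵇ⇒< _ _ b)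
... | inj₂ t₂ with ∨-elim (closeᵇ k i j) t₂
... | inj₁ t₁ = let a , b = ∧-elim (i ≡ᵇ 0) t₁ in close (≡ᵇ⇒≡ _ _ a) (≡ᵇ⇒≡ _ _ b)
... | inj₂ t₃ with ∨-elim (chordᵇ k i j) t₃
... | inj₁ t₁ = let a , b = ∧-elim (i <ᵇ k) t₁ in chord (<ᵇ⇒< _ _ a) (≡ᵇ⇒≡ _ _ b)
... | inj₂ t₄ with ∨-elim (spokeᵇ k i j) t₄
... | inj₁ t₁ = let a , b = ∧-elim (i ≡ᵇ 2 * k) t₁ in spoke (≡ᵇ⇒≡ _ _ a) (≡ᵇ-+⇒≡ 0 b)
... | inj₂ t₅ with ∨-elim (leaf₁ᵇ k i j) t₅
... | inj₁ t₁ = let a , b = ∧-elim (i ≡ᵇ 2 * k + 1) t₁ in leaf₁ (≡ᵇ-+⇒≡ 0 a) (≡ᵇ-+⇒≡ 1 b)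
... | inj₂ t₁ = let a , b = ∧-elim (i ≡ᵇ 2 * k + 1) t₁ in leaf₂ (≡ᵇ-+⇒≡ 0 a) (≡ᵇ-+⇒≡ 2 b)

Arc⇒baseEdge : ∀ {k i j} → Arc k i j → T (baseEdge k i j)
Arc⇒baseEdge (path p q) = ∨-introˡ _ (∧-intro (≡⇒≡ᵇ _ _ p) (<⇒<ᵇ q))
Arc⇒baseEdge {k} {i} {j} (close p q) = ∨-introʳ (pathᵇ k i j) (∨-introˡ _ (∧-intro (≡⇒≡ᵇ _ _ p) (≡⇒≡ᵇ _ _ q)))
Arc⇒baseEdge {k} {i} {j} (chord p q) = ∨-introʳ (pathᵇ k i j) (∨-introʳ (closeᵇ k i j)
  (∨-introˡ _ (∧-intro (<⇒<ᵇ p) (≡⇒≡ᵇ _ _ q))))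
Arc⇒baseEdge {k} {i} {j} (spoke p q) = ∨-introʳ (pathᵇ k i j) (∨-introʳ (closeᵇ k i j) (∨-introʳ (chordᵇ k i j)
  (∨-introˡ _ (∧-intro (≡⇒≡ᵇ _ _ p) (≡⇒≡ᵇ-+ 0 q)))))
Arc⇒baseEdge {k} {i} {j} (leaf₁ p q) = ∨-introʳ (pathᵇ k i j) (∨-introʳ (closeᵇ k i j) (∨-introʳ (chordᵇ k i j)
  (∨-introʳ (spokeᵇ k i j) (∨-introˡ _ (∧-intro (≡⇒≡ᵇ-+ 0 p) (≡⇒≡ᵇ-+ 1 q))))))
Arc⇒baseEdge {k} {i} {j} (leaf₂ p q) = ∨-introʳ (pathᵇ k i j) (∨-introʳ (closeᵇ k i j) (∨-introʳ (chordᵇ k i j)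
  (∨-introʳ (spokeᵇ k i j) (∨-introʳ (leaf₁ᵇ k i j) (∧-intro (≡⇒≡ᵇ-+ 0 p) (≡⇒≡ᵇ-+ 2 q))))))

Arc⇒< : ∀ {k i j} → 1 ≤ k → Arc k i j → i < j
Arc⇒< _ (path refl _) = n<1+n _
Arc⇒< {k} 1≤k (close refl refl) = ≤-trans 1≤k (m≤m+n k (k + 0))
Arc⇒< 1≤k (chord _ refl) = m<m+n _ 1≤k
Arc⇒< _ (spoke refl refl) = n<1+n _
Arc⇒< _ (leaf₁ refl refl) = n<1+n _
Arc⇒< _ (leaf₂ refl refl) = m<n⇒m<1+n (n<1+n _)

Edge⇒≢ : ∀ {k i j} → 1 ≤ k → Edge k i j → i ≢ j
Edge⇒≢ 1≤k (inj₁ arc) = <⇒≢ (Arc⇒< 1≤k arc)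
Edge⇒≢ 1≤k (inj₂ arc) = >⇒≢ (Arc⇒< 1≤k arc)

adj⇒Edge : ∀ {k i j} → adj k i j ≡ true → Edge k i j
adj⇒Edge {k} {i} {j} e with ∨-elim (baseEdge k i j) (proj₂ (∧-elim (not (i ≡ᵇ j)) (T-≡ .from e)))
... | inj₁ t = inj₁ (baseEdge⇒Arc k i j t)
... | inj₂ t = inj₂ (baseEdge⇒Arc k j i t)

Edge⇒adj : ∀ {k i j} → 1 ≤ k → Edge k i j → adj k i j ≡ true
Edge⇒adj {k} {i} {j} 1≤k edge = T-≡ .to (∧-intro (T-not-≡ .from i≢ᵇj) (either edge))
  where
  i≢ᵇj : (i ≡ᵇ j) ≡ false
  i≢ᵇj = ¬-not (Edge⇒≢ 1≤k edge ∘ ≡ᵇ⇒≡ i j ∘ T-≡ .from)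
  either : Edge k i j → T (baseEdge k i j ∨ baseEdge k j i)
  either (inj₁ arc) = ∨-introˡ _ (Arc⇒baseEdge arc)
  either (inj₂ arc) = ∨-introʳ (baseEdge k i j) (Arc⇒baseEdge arc)

Arc⇒target≤ : ∀ {k i j} → Arc k i j → j ≤ 3 + 2 * k
Arc⇒target≤ (path refl i<2k) = ≤-trans i<2k (m≤n+m _ 3)
Arc⇒target≤ {k} (close _ refl) = m≤n+m _ 3
Arc⇒target≤ {k} {i} (chord i<k refl) =
  ≤-trans (<⇒≤ (subst (i + k <_) (cong (k +_) (sym (+-identityʳ k))) (+-monoˡ-< k i<k))) (m≤n+m _ 3)
Arc⇒target≤ (spoke _ refl) = ≤-trans (n≤1+n _) (n≤1+n _)
Arc⇒target≤ (leaf₁ _ refl) = n≤1+n _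
Arc⇒target≤ (leaf₂ _ refl) = ≤-refl

Edge⇒≤ : ∀ {k i j} → 1 ≤ k → Edge k i j → j ≤ 3 + 2 * k
Edge⇒≤ _ (inj₁ arc) = Arc⇒target≤ arc
Edge⇒≤ 1≤k (inj₂ arc) = ≤-trans (<⇒≤ (Arc⇒< 1≤k arc)) (Arc⇒target≤ arc)

Neighbours : ℕ → ℕ → List ℕ → Set
Neighbours k i L = (∀ {j} → Edge k i j → j ∈ L) × (∀ {j} → j ∈ L → Edge k i j)

module Neighbourhoods {k} (1≤k : 1 ≤ k) where

  k<2k : k < 2 * k
  k<2k = m<m+n k (≤-trans 1≤k (≤-reflexive (sym (+-identityʳ k))))

  0<2k : 0 < 2 * k
  0<2k = <-trans (≤-trans z<s 1≤k) k<2k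

  +k<2k : ∀ {r} → r < k → r + k < 2 * k
  +k<2k {r} r<k = subst (r + k <_) (cong (k +_) (sym (+-identityʳ k))) (+-monoˡ-< k r<k)

  <2k⇒≢ : ∀ {i} c → i < 2 * k → i ≢ c + 2 * k
  <2k⇒≢ c i<2k = <⇒≢ (<-≤-trans i<2k (m≤n+m (2 * k) c))

  ≤2k⇒≢ : ∀ {i} c → i ≤ 2 * k → i ≢ suc c + 2 * k
  ≤2k⇒≢ c i≤2k = <⇒≢ (s≤s (≤-trans i≤2k (m≤n+m (2 * k) c)))

  neighbours-0 : Neighbours k 0 (1 ∷ k ∷ 2 * k ∷ [])
  neighbours-0 = sound , complete
    where
    sound : ∀ {j} → Edge k 0 j → j ∈ 1 ∷ k ∷ 2 * k ∷ []
    sound (inj₁ (path refl _)) = here refl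
    sound (inj₁ (close _ refl)) = there (there (here refl))
    sound (inj₁ (chord _ refl)) = there (here refl)
    sound (inj₁ (spoke p _)) = ⊥-elim (<2k⇒≢ 0 0<2k p)
    sound (inj₁ (leaf₁ () _))
    sound (inj₁ (leaf₂ () _))
    sound (inj₂ (path () _))
    sound (inj₂ (close _ p)) = ⊥-elim (<2k⇒≢ 0 0<2k p)
    sound {j} (inj₂ (chord _ p)) = ⊥-elim (<⇒≢ (≤-trans 1≤k (m≤n+m k j)) p)
    sound (inj₂ (spoke _ ()))
    sound (inj₂ (leaf₁ _ ()))
    sound (inj₂ (leaf₂ _ ()))
    complete : ∀ {j} → j ∈ 1 ∷ k ∷ 2 * k ∷ [] → Edge k 0 j
    complete (here refl) = inj₁ (path refl 0<2k)
    complete (there (here refl)) = inj₁ (chord (≤-trans z<s 1≤k) refl)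
    complete (there (there (here refl))) = inj₁ (close refl refl)

  neighbours-lower : ∀ {a} → suc a < k → Neighbours k (suc a) (a ∷ suc (suc a) ∷ suc a + k ∷ [])
  neighbours-lower {a} i<k = sound , complete
    where
    i<2k = <-trans i<k k<2k
    sound : ∀ {j} → Edge k (suc a) j → j ∈ a ∷ suc (suc a) ∷ suc a + k ∷ []
    sound (inj₁ (path refl _)) = there (here refl)
    sound (inj₁ (close () _))
    sound (inj₁ (chord _ refl)) = there (there (here refl))
    sound (inj₁ (spoke p _)) = ⊥-elim (<2k⇒≢ 0 i<2k p)
    sound (inj₁ (leaf₁ p _)) = ⊥-elim (<2k⇒≢ 1 i<2k p)
    sound (inj₁ (leaf₂ p _)) = ⊥-elim (<2k⇒≢ 1 i<2k p)
    sound (inj₂ (path p _)) = here (suc-injective (sym p))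
    sound (inj₂ (close _ p)) = ⊥-elim (<2k⇒≢ 0 i<2k p)
    sound {j} (inj₂ (chord _ p)) = ⊥-elim (<⇒≢ (<-≤-trans i<k (m≤n+m k j)) p)
    sound (inj₂ (spoke _ p)) = ⊥-elim (<2k⇒≢ 1 i<2k p)
    sound (inj₂ (leaf₁ _ p)) = ⊥-elim (<2k⇒≢ 2 i<2k p)
    sound (inj₂ (leaf₂ _ p)) = ⊥-elim (<2k⇒≢ 3 i<2k p)
    complete : ∀ {j} → j ∈ a ∷ suc (suc a) ∷ suc a + k ∷ [] → Edge k (suc a) j
    complete (here refl) = inj₂ (path refl (<-trans (n<1+n a) i<2k))
    complete (there (here refl)) = inj₁ (path refl i<2k)
    complete (there (there (here refl))) = inj₁ (chord i<k refl)

  neighbours-upper : ∀ {r p} → r < k → suc p ≡ r + k → Neighbours k (r + k) (p ∷ suc (r + k) ∷ r ∷ [])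
  neighbours-upper {r} {p} r<k 1+p≡i = sound , complete
    where
    i<2k = +k<2k r<k
    sound : ∀ {j} → Edge k (r + k) j → j ∈ p ∷ suc (r + k) ∷ r ∷ []
    sound (inj₁ (path refl _)) = there (here refl)
    sound (inj₁ (close q _)) = ⊥-elim (>⇒≢ (≤-trans 1≤k (m≤n+m k r)) q)
    sound (inj₁ (chord q _)) = ⊥-elim (<⇒≱ q (m≤n+m k r))
    sound (inj₁ (spoke q _)) = ⊥-elim (<2k⇒≢ 0 i<2k q)
    sound (inj₁ (leaf₁ q _)) = ⊥-elim (<2k⇒≢ 1 i<2k q)
    sound (inj₁ (leaf₂ q _)) = ⊥-elim (<2k⇒≢ 1 i<2k q)
    sound (inj₂ (path q _)) = here (suc-injective (trans (sym q) (sym 1+p≡i)))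
    sound (inj₂ (close _ q)) = ⊥-elim (<2k⇒≢ 0 i<2k q)
    sound {j} (inj₂ (chord _ q)) = there (there (here (sym (+-cancelʳ-≡ k r j q))))
    sound (inj₂ (spoke _ q)) = ⊥-elim (<2k⇒≢ 1 i<2k q)
    sound (inj₂ (leaf₁ _ q)) = ⊥-elim (<2k⇒≢ 2 i<2k q)
    sound (inj₂ (leaf₂ _ q)) = ⊥-elim (<2k⇒≢ 3 i<2k q)
    complete : ∀ {j} → j ∈ p ∷ suc (r + k) ∷ r ∷ [] → Edge k (r + k) j
    complete (here refl) = inj₂ (path (sym 1+p≡i) (<-trans (subst (p <_) 1+p≡i (n<1+n p)) i<2k))
    complete (there (here refl)) = inj₁ (path refl i<2k)
    complete (there (there (here refl))) = inj₂ (chord r<k refl)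

  neighbours-2k : ∀ {p} → suc p ≡ 2 * k → Neighbours k (2 * k) (p ∷ 0 ∷ 1 + 2 * k ∷ [])
  neighbours-2k {p} 1+p≡2k = sound , complete
    where
    sound : ∀ {j} → Edge k (2 * k) j → j ∈ p ∷ 0 ∷ 1 + 2 * k ∷ []
    sound (inj₁ (path _ q)) = ⊥-elim (<-irrefl refl q)
    sound (inj₁ (close q _)) = ⊥-elim (>⇒≢ 0<2k q)
    sound (inj₁ (chord q _)) = ⊥-elim (<⇒≱ q (m≤m+n k (k + 0)))
    sound (inj₁ (spoke _ refl)) = there (there (here refl))
    sound (inj₁ (leaf₁ q _)) = ⊥-elim (≤2k⇒≢ 0 ≤-refl q)
    sound (inj₁ (leaf₂ q _)) = ⊥-elim (≤2k⇒≢ 0 ≤-refl q)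
    sound (inj₂ (path q _)) = here (suc-injective (trans (sym q) (sym 1+p≡2k)))
    sound (inj₂ (close refl _)) = there (here refl)
    sound (inj₂ (chord j<k q)) = ⊥-elim (>⇒≢ (+k<2k j<k) q)
    sound (inj₂ (spoke _ q)) = ⊥-elim (≤2k⇒≢ 0 ≤-refl q)
    sound (inj₂ (leaf₁ _ q)) = ⊥-elim (≤2k⇒≢ 1 ≤-refl q)
    sound (inj₂ (leaf₂ _ q)) = ⊥-elim (≤2k⇒≢ 2 ≤-refl q)
    complete : ∀ {j} → j ∈ p ∷ 0 ∷ 1 + 2 * k ∷ [] → Edge k (2 * k) j
    complete (here refl) = inj₂ (path (sym 1+p≡2k) (subst (p <_) 1+p≡2k (n<1+n p)))
    complete (there (here refl)) = inj₂ (close refl refl)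
    complete (there (there (here refl))) = inj₁ (spoke refl refl)

  neighbours-y : Neighbours k (1 + 2 * k) (2 * k ∷ 2 + 2 * k ∷ 3 + 2 * k ∷ [])
  neighbours-y = sound , complete
    where
    sound : ∀ {j} → Edge k (1 + 2 * k) j → j ∈ 2 * k ∷ 2 + 2 * k ∷ 3 + 2 * k ∷ []
    sound (inj₁ (path _ q)) = ⊥-elim (<-asym q (n<1+n _))
    sound (inj₁ (close () _))
    sound (inj₁ (chord q _)) = ⊥-elim (<⇒≱ q (≤-trans (m≤m+n k (k + 0)) (n≤1+n _)))
    sound (inj₁ (spoke q _)) = ⊥-elim (>⇒≢ (n<1+n _) q)
    sound (inj₁ (leaf₁ _ refl)) = there (here refl)
    sound (inj₁ (leaf₂ _ refl)) = there (there (here refl))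
    sound (inj₂ (path q _)) = here (sym (suc-injective q))
    sound (inj₂ (close _ q)) = ⊥-elim (>⇒≢ (n<1+n _) q)
    sound (inj₂ (chord j<k q)) = ⊥-elim (>⇒≢ (<-trans (+k<2k j<k) (n<1+n _)) q)
    sound (inj₂ (spoke refl _)) = here refl
    sound (inj₂ (leaf₁ _ q)) = ⊥-elim (<⇒≢ (n<1+n _) q)
    sound (inj₂ (leaf₂ _ q)) = ⊥-elim (<⇒≢ (m<n⇒m<1+n (n<1+n _)) q)
    complete : ∀ {j} → j ∈ 2 * k ∷ 2 + 2 * k ∷ 3 + 2 * k ∷ [] → Edge k (1 + 2 * k) j
    complete (here refl) = inj₂ (spoke refl refl)
    complete (there (here refl)) = inj₁ (leaf₁ refl refl)
    complete (there (there (here refl))) = inj₁ (leaf₂ refl refl)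

  neighbours-x₁ : Neighbours k (2 + 2 * k) (1 + 2 * k ∷ [])
  neighbours-x₁ = sound , complete
    where
    sound : ∀ {j} → Edge k (2 + 2 * k) j → j ∈ 1 + 2 * k ∷ []
    sound (inj₁ (path _ q)) = ⊥-elim (<⇒≱ q (≤-trans (n≤1+n _) (n≤1+n _)))
    sound (inj₁ (close () _))
    sound (inj₁ (chord q _)) = ⊥-elim (<⇒≱ q (≤-trans (m≤m+n k (k + 0)) (≤-trans (n≤1+n _) (n≤1+n _))))
    sound (inj₁ (spoke q _)) = ⊥-elim (>⇒≢ (m<n⇒m<1+n (n<1+n _)) q)
    sound (inj₁ (leaf₁ q _)) = ⊥-elim (>⇒≢ (n<1+n _) q)
    sound (inj₁ (leaf₂ q _)) = ⊥-elim (>⇒≢ (n<1+n _) q)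
    sound (inj₂ (path q j<2k)) = ⊥-elim (<⇒≱ j<2k (≤-trans (n≤1+n _) (≤-reflexive (suc-injective q))))
    sound (inj₂ (close _ q)) = ⊥-elim (>⇒≢ (m<n⇒m<1+n (n<1+n _)) q)
    sound (inj₂ (chord j<k q)) = ⊥-elim (>⇒≢ (<-trans (+k<2k j<k) (m<n⇒m<1+n (n<1+n _))) q)
    sound (inj₂ (spoke _ q)) = ⊥-elim (>⇒≢ (n<1+n _) q)
    sound (inj₂ (leaf₁ refl _)) = here refl
    sound (inj₂ (leaf₂ _ q)) = ⊥-elim (<⇒≢ (n<1+n _) q)
    complete : ∀ {j} → j ∈ 1 + 2 * k ∷ [] → Edge k (2 + 2 * k) j
    complete (here refl) = inj₂ (leaf₁ refl refl)

  neighbours-x₂ : Neighbours k (3 + 2 * k) (1 + 2 * k ∷ [])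
  neighbours-x₂ = sound , complete
    where
    sound : ∀ {j} → Edge k (3 + 2 * k) j → j ∈ 1 + 2 * k ∷ []
    sound (inj₁ (path _ q)) = ⊥-elim (<⇒≱ q (≤-trans (n≤1+n _) (≤-trans (n≤1+n _) (n≤1+n _))))
    sound (inj₁ (close () _))
    sound (inj₁ (chord q _)) = ⊥-elim (<⇒≱ q (≤-trans (m≤m+n k (k + 0)) (≤-trans (n≤1+n _) (≤-trans (n≤1+n _) (n≤1+n _)))))
    sound (inj₁ (spoke q _)) = ⊥-elim (>⇒≢ (m<n⇒m<1+n (m<n⇒m<1+n (n<1+n _))) q)
    sound (inj₁ (leaf₁ q _)) = ⊥-elim (>⇒≢ (m<n⇒m<1+n (n<1+n _)) q)
    sound (inj₁ (leaf₂ q _)) = ⊥-elim (>⇒≢ (m<n⇒m<1+n (n<1+n _)) q)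
    sound (inj₂ (path q j<2k)) = ⊥-elim (<⇒≱ j<2k (≤-trans (≤-trans (n≤1+n _) (n≤1+n _)) (≤-reflexive (suc-injective q))))
    sound (inj₂ (close _ q)) = ⊥-elim (>⇒≢ (m<n⇒m<1+n (m<n⇒m<1+n (n<1+n _))) q)
    sound (inj₂ (chord j<k q)) = ⊥-elim (>⇒≢ (<-trans (+k<2k j<k) (m<n⇒m<1+n (m<n⇒m<1+n (n<1+n _)))) q)
    sound (inj₂ (spoke _ q)) = ⊥-elim (>⇒≢ (m<n⇒m<1+n (n<1+n _)) q)
    sound (inj₂ (leaf₁ _ q)) = ⊥-elim (>⇒≢ (n<1+n _) q)
    sound (inj₂ (leaf₂ refl _)) = here refl
    complete : ∀ {j} → j ∈ 1 + 2 * k ∷ [] → Edge k (3 + 2 * k) j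
    complete (here refl) = inj₂ (leaf₂ refl refl)

module Degrees {k} (2≤k : 2 ≤ k) where

  1≤k : 1 ≤ k
  1≤k = ≤-trans (s≤s z≤n) 2≤k

  open Neighbourhoods 1≤k

  order : ℕ
  order = 2 * k + 4

  <order : ∀ {i} → i ≤ 3 + 2 * k → i < order
  <order {i} i≤ = subst (i <_) (+-comm 4 (2 * k)) (s≤s i≤)

  beyond-y : ∀ {i} → 1 + 2 * k < i → i < order → i ≡ 2 + 2 * k ⊎ i ≡ 3 + 2 * k
  beyond-y {i} y<i i<order with i ≟ 2 + 2 * k
  ... | yes i≡x₁ = inj₁ i≡x₁
  ... | no i≢x₁ = inj₂ (≤-antisym (s≤s⁻¹ (subst (i <_) (+-comm (2 * k) 4) i<order)) (≤∧≢⇒< y<i (i≢x₁ ∘ sym)))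

  count-Neighbours : ∀ {i L} → Neighbours k i L → Unique L → count (adj k i) order ≡ length L
  count-Neighbours {L = L} (sound , complete) unique =
    count-∈ order L unique (All.tabulate (λ j∈L → <order (Edge⇒≤ 1≤k (complete j∈L))))
            (λ _ e → sound (adj⇒Edge e)) (λ j∈L → Edge⇒adj 1≤k (complete j∈L))

  deg : ℕ → ℕ
  deg i = count (adj k i) order

  degree-0 : deg 0 ≡ 3
  degree-0 = count-Neighbours neighbours-0 (unique₃ (<⇒≢ 2≤k) (<⇒≢ (<-trans 2≤k k<2k)) (<⇒≢ k<2k))

  degree-lower : ∀ {a} → suc a < k → deg (suc a) ≡ 3
  degree-lower {a} i<k = count-Neighbours (neighbours-lower i<k)
    (unique₃ (<⇒≢ (m<n⇒m<1+n (n<1+n a))) (<⇒≢ (<-≤-trans (n<1+n a) (m≤m+n (suc a) k))) (<⇒≢ 2+a<1+a+k))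
    where
    2+a<1+a+k : suc (suc a) < suc a + k
    2+a<1+a+k = subst (_< suc a + k) (+-comm (suc a) 1) (+-monoʳ-< (suc a) 2≤k)

  degree-upper : ∀ {r p} → r < k → suc p ≡ r + k → deg (r + k) ≡ 3
  degree-upper {r} {p} r<k 1+p≡r+k = count-Neighbours (neighbours-upper r<k 1+p≡r+k)
    (unique₃ (<⇒≢ (≤-trans (≤-reflexive 1+p≡r+k) (n≤1+n _))) (>⇒≢ r<p) (>⇒≢ (s≤s (m≤m+n r k))))
    where
    r<p : r < p
    r<p = s≤s⁻¹ (subst (2 + r ≤_) (sym 1+p≡r+k) (subst (_≤ r + k) (+-comm r 2) (+-monoʳ-≤ r 2≤k)))

  degree-2k : ∀ {p} → suc p ≡ 2 * k → deg (2 * k) ≡ 3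
  degree-2k {p} 1+p≡2k = count-Neighbours (neighbours-2k 1+p≡2k)
    (unique₃ (>⇒≢ 0<p) (<⇒≢ (<-trans (subst (p <_) 1+p≡2k (n<1+n p)) (n<1+n _))) (λ ()))
    where
    0<p : 0 < p
    0<p = s≤s⁻¹ (≤-trans (≤-trans 2≤k (<⇒≤ k<2k)) (≤-reflexive (sym 1+p≡2k)))

  degree-y : deg (1 + 2 * k) ≡ 3
  degree-y = count-Neighbours neighbours-y
    (unique₃ (<⇒≢ (m<n⇒m<1+n (n<1+n _))) (<⇒≢ (m<n⇒m<1+n (m<n⇒m<1+n (n<1+n _)))) (<⇒≢ (n<1+n _)))

  degree-cycle : ∀ {i} → i < 2 + 2 * k → deg i ≡ 3
  degree-cycle {zero} _ = degree-0
  degree-cycle {suc a} i<2+2k with suc a <? k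
  ... | yes i<k = degree-lower i<k
  ... | no i≮k with suc a <? 2 * k
  ... | yes i<2k = subst (λ i → deg i ≡ 3) r+k≡i (degree-upper r<k (sym r+k≡i))
    where
    r = suc a ∸ k
    r+k≡i : r + k ≡ suc a
    r+k≡i = m∸n+n≡m (≮⇒≥ i≮k)
    r<k : r < k
    r<k = +-cancelʳ-< k r k (subst (_< k + k) (sym r+k≡i) (subst (suc a <_) (cong (k +_) (+-identityʳ k)) i<2k))
  ... | no i≮2k with suc a ≟ 2 * k
  ... | yes i≡2k = subst (λ i → deg i ≡ 3) (sym i≡2k) (degree-2k i≡2k)
  ... | no i≢2k = subst (λ i → deg i ≡ 3) (sym i≡1+2k) degree-y
    where
    i≡1+2k : suc a ≡ 1 + 2 * k
    i≡1+2k = ≤-antisym (s≤s⁻¹ i<2+2k) (≤∧≢⇒< (≮⇒≥ i≮2k) (i≢2k ∘ sym))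

  degree-x₁ : deg (2 + 2 * k) ≡ 1
  degree-x₁ = count-Neighbours neighbours-x₁ ([] ∷ [])

  degree-x₂ : deg (3 + 2 * k) ≡ 1
  degree-x₂ = count-Neighbours neighbours-x₂ ([] ∷ [])

  open Gℕ k

  degrees : map (degree (G k)) (allFin order) ≡ replicate (2 + 2 * k) 3 ++ 1 ∷ 1 ∷ []
  degrees = begin
    map (degree (G k)) (allFin order)                   ≡⟨ map-tabulate (λ v → v) (degree (G k)) ⟩
    List.tabulate (degree (G k))                        ≡⟨ tabulate-cong degree≡count ⟩
    List.tabulate (deg ∘ toℕ)                           ≡⟨ cong (λ n → List.tabulate {n = n} (deg ∘ toℕ)) order≡ ⟩
    List.tabulate {n = (2 + 2 * k) + 2} (deg ∘ toℕ)     ≡⟨ tabulate-replicate (2 + 2 * k) deg degree-cycle ⟩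
    replicate (2 + 2 * k) 3 ++ deg (2 + 2 * k + 0) ∷ deg (2 + 2 * k + 1) ∷ []
      ≡⟨ cong (replicate (2 + 2 * k) 3 ++_) (cong₂ (λ a b → a ∷ b ∷ [])
           (trans (cong deg (+-identityʳ _)) degree-x₁) (trans (cong deg (+-comm _ 1)) degree-x₂)) ⟩
    replicate (2 + 2 * k) 3 ++ 1 ∷ 1 ∷ []               ∎
    where
    open ≡-Reasoning
    order≡ : order ≡ (2 + 2 * k) + 2
    order≡ = trans (+-comm (2 * k) 4) (+-comm 2 (2 + 2 * k))

3k+4≡4+k*3 : ∀ k → 3 * k + 4 ≡ 4 + k * 3
3k+4≡4+k*3 k = trans (+-comm (3 * k) 4) (cong (4 +_) (*-comm 3 k))

prefix-bound : ∀ {k j} → 2 + j * 3 ≤ 3 * k + 4 → j ≤ k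
prefix-bound {k} {j} le with j ≤? k
... | yes j≤k = j≤k
... | no j≰k = ⊥-elim (<⇒≱ too-big le)
  where
  too-big : 3 * k + 4 < 2 + j * 3
  too-big = begin-strict
    3 * k + 4        ≡⟨ 3k+4≡4+k*3 k ⟩
    4 + k * 3        <⟨ n<1+n _ ⟩
    2 + suc k * 3    ≤⟨ +-monoʳ-≤ 2 (*-monoˡ-≤ 3 (≰⇒> j≰k)) ⟩
    2 + j * 3        ∎
    where open ≤-Reasoning

module Annihilation {k} (2≤k : 2 ≤ k) where
  open Degrees 2≤k

  sorted-degrees : sortedDegrees (G k) ≡ 1 ∷ 1 ∷ replicate (2 + 2 * k) 3
  sorted-degrees = trans (cong Sorting.sort degrees) (sort-degree-sequence (2 + 2 * k))

  numEdges-G : numEdges (G k) ≡ 3 * k + 4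
  numEdges-G = m+m≡n+n⇒m≡n (begin
    numEdges (G k) + numEdges (G k)                   ≡⟨ sym (handshake (G k)) ⟩
    sum (map (degree (G k)) (allFin order))           ≡⟨ cong sum degrees ⟩
    sum (replicate (2 + 2 * k) 3 ++ 1 ∷ 1 ∷ [])       ≡⟨ sum-++ (replicate (2 + 2 * k) 3) _ ⟩
    sum (replicate (2 + 2 * k) 3) + 2                 ≡⟨ cong (_+ 2) (sum-replicate (2 + 2 * k) 3) ⟩
    (2 + 2 * k) * 3 + 2                               ≡⟨ degree-sum≡ k ⟩
    (3 * k + 4) + (3 * k + 4)                         ∎)
    where
    open ≡-Reasoning
    degree-sum≡ : ∀ k → (2 + 2 * k) * 3 + 2 ≡ (3 * k + 4) + (3 * k + 4)
    degree-sum≡ = solve-∀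

  degree-sequence : List ℕ
  degree-sequence = 1 ∷ 1 ∷ replicate (2 + 2 * k) 3

  prefix-sum : ∀ {j} → j ≤ 2 + 2 * k → sum (List.take (2 + j) degree-sequence) ≡ 2 + j * 3
  prefix-sum j≤ = cong (2 +_) (sum-take-replicate 3 j≤)

  prefix-fits : sum (List.take (k + 2) degree-sequence) ≤ 3 * k + 4
  prefix-fits = subst (λ j → sum (List.take j degree-sequence) ≤ 3 * k + 4) (+-comm 2 k) (begin
    sum (List.take (2 + k) degree-sequence)   ≡⟨ prefix-sum (≤-trans (m≤m+n k (k + 0)) (m≤n+m _ 2)) ⟩
    2 + k * 3                                 ≤⟨ +-monoˡ-≤ (k * 3) (s≤s (s≤s z≤n)) ⟩
    4 + k * 3                                 ≡⟨ 3k+4≡4+k*3 k ⟨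
    3 * k + 4                                 ∎)
    where open ≤-Reasoning

  prefix-maximal : ∀ j → j ≤ order → sum (List.take j degree-sequence) ≤ 3 * k + 4 → j ≤ k + 2
  prefix-maximal 0 _ _ = z≤n
  prefix-maximal 1 _ _ = ≤-trans (s≤s z≤n) (m≤n+m 2 k)
  prefix-maximal (suc (suc j)) j≤order fits-j =
    subst (2 + j ≤_) (+-comm 2 k) (s≤s (s≤s (prefix-bound (≤-trans (≤-reflexive (sym (prefix-sum j≤2+2k))) fits-j))))
    where
    j≤2+2k : j ≤ 2 + 2 * k
    j≤2+2k = s≤s⁻¹ (s≤s⁻¹ (subst (2 + j ≤_) (+-comm (2 * k) 4) j≤order))

  annihilation : IsAnnihilationNumber (G k) (k + 2)
  annihilation =
      +-mono-≤ (m≤m+n k (k + 0)) (s≤s (s≤s z≤n))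
    , subst₂ (λ D E → sum (List.take (k + 2) D) ≤ E) (sym sorted-degrees) (sym numEdges-G) prefix-fits
    , λ j j≤order fits-j →
        prefix-maximal j j≤order (subst₂ (λ D E → sum (List.take j D) ≤ E) sorted-degrees numEdges-G fits-j)

cycle-bound : ∀ {k c d} → (c ≡ 0 ⊎ suc c ≤ d) → c + d ≤ suc (2 * k) → c ≤ k
cycle-bound (inj₁ refl) _ = z≤n
cycle-bound {k} {c} {d} (inj₂ c<d) c+d≤ = *-cancelˡ-≤ 2 (s≤s⁻¹ (begin
  suc (2 * c)   ≡⟨ cong suc (cong (c +_) (+-identityʳ c)) ⟩
  suc (c + c)   ≡⟨ sym (+-suc c c) ⟩
  c + suc c     ≤⟨ +-monoʳ-≤ c c<d ⟩
  c + d         ≤⟨ c+d≤ ⟩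
  suc (2 * k)   ∎))
  where open ≤-Reasoning

excess-bounds : ∀ {c d a b} → (c ≡ 0 ⊎ suc c ≤ d) → a ≤ 2 → a ≤ suc b →
                c + a ≤ suc (d + b) × (c + a ≤ 2 ⊎ c + a ≤ d + b)
excess-bounds {d = d} {b = b} (inj₁ refl) a≤2 a≤1+b = ≤-trans a≤1+b (s≤s (m≤n+m b d)) , inj₁ a≤2
excess-bounds {c} {d} {a} {b} (inj₂ c<d) _ a≤1+b = ≤-trans c+a≤d+b (n≤1+n _) , inj₂ c+a≤d+b
  where
  c+a≤d+b : c + a ≤ d + b
  c+a≤d+b = ≤-trans (+-monoʳ-≤ c a≤1+b) (≤-trans (≤-reflexive (+-suc c b)) (+-monoˡ-≤ b c<d))

module Independence {k} (2≤k : 2 ≤ k) where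
  open Degrees 2≤k using (1≤k; order; <order)
  open Neighbourhoods 1≤k using (0<2k)
  open Gℕ k

  Nbhd-edge : ∀ S {i j} → at S i ≡ true → Edge k i j → at (Nbhd (G k) S) j ≡ true
  Nbhd-edge S Si e = Nbhd-intro S Si (Edge⇒adj 1≤k e) (<order (Edge⇒≤ 1≤k e))

  no-edge : ∀ {S} → Independent (G k) S → ∀ {i j} → at S i ≡ true → at S j ≡ true → Edge k i j → ⊥
  no-edge indep Si Sj e = case trans (sym (Edge⇒adj 1≤k e)) (independent⇒adj-false indep Si Sj) of λ ()

  star-count : (ℕ → Bool) → ℕ
  star-count f = χ (f (1 + 2 * k)) + χ (f (2 + 2 * k)) + χ (f (3 + 2 * k))

  count-cycle+star : ∀ f → count f order ≡ count f (1 + 2 * k) + star-count f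
  count-cycle+star f = trans (cong (count f) (+-comm (2 * k) 4)) (count-last₃ f (1 + 2 * k))

  tabulated : (ℕ → Bool) → Subset order
  tabulated f = tabulate (f ∘ toℕ)

  at-tabulated : ∀ f {i} → at (tabulated f) i ≡ true → f i ≡ true
  at-tabulated f Fi = trans (sym (at-tabulate f (at-true⇒< (tabulated f) Fi))) Fi

  tabulated-independent : ∀ f → (∀ {i j} → Arc k i j → f i ≡ true → f j ≡ true → ⊥) → Independent (G k) (tabulated f)
  tabulated-independent f no-arc′ =
    adj-false⇒independent (λ Fi Fj → ¬-not (λ i~j → either (adj⇒Edge i~j) (at-tabulated f Fi) (at-tabulated f Fj)))
    where
    either : ∀ {i j} → Edge k i j → f i ≡ true → f j ≡ true → ⊥
    either (inj₁ arc) fi fj = no-arc′ arc fi fj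
    either (inj₂ arc) fi fj = no-arc′ arc fj fi

  ∣tabulated∣ : ∀ f → ∣ tabulated f ∣ ≡ count f order
  ∣tabulated∣ f = trans (∣∣≡count (tabulated f)) (count-cong order (at-tabulate f))

  module _ {S} (indep : Independent (G k) S) where
    private
      s t : ℕ → Bool
      s = at S
      t = at (Nbhd (G k) S)

    cycle-surplus : count s (1 + 2 * k) ≡ 0 ⊎ suc (count s (1 + 2 * k)) ≤ count t (1 + 2 * k)
    cycle-surplus with anyUpTo? (λ i → s i Bool.≟ true) (1 + 2 * k)
    ... | no none = inj₁ (count-none (1 + 2 * k) (λ i< → ¬-not (λ si → none (_ , i< , si))))
    ... | yes (j , j<1+2k , sj) = inj₂ (surplus
      (λ s0 s1 → no-edge indep s0 s1 (inj₁ (path refl 0<2k)))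
      (λ i<2k si → Nbhd-edge S si (inj₁ (path refl i<2k)))
      (λ i<2k s[1+i] → Nbhd-edge S s[1+i] (inj₂ (path refl i<2k)))
      (λ s0 → Nbhd-edge S s0 (inj₁ (close refl refl)))
      (λ s2k → Nbhd-edge S s2k (inj₂ (close refl refl)))
      (s≤s⁻¹ j<1+2k) sj)
      where
      open Surplus {2 * k} {pred k} (cong (2 *_) (sym (suc-pred k {{>-nonZero 1≤k}})))

    cycle-disjoint : count s (1 + 2 * k) + count t (1 + 2 * k) ≤ 1 + 2 * k
    cycle-disjoint = count-disjoint {s} {t} (1 + 2 * k) (λ {i} _ → Nbhd-disjoint indep i)

    star-bound : star-count s ≤ 2 × star-count s ≤ suc (star-count t)
    star-bound = star-bounds
      (λ sy → ¬-not (λ sx₁ → no-edge indep sy sx₁ (inj₁ (leaf₁ refl refl))) ,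
              ¬-not (λ sx₂ → no-edge indep sy sx₂ (inj₁ (leaf₂ refl refl))) ,
              Nbhd-edge S sy (inj₁ (leaf₁ refl refl)) , Nbhd-edge S sy (inj₁ (leaf₂ refl refl)))
      (λ sx₁ → Nbhd-edge S sx₁ (inj₂ (leaf₁ refl refl)))
      (λ sx₂ → Nbhd-edge S sx₂ (inj₂ (leaf₂ refl refl)))

    size-bound : ∣ S ∣ ≤ k + 2
    size-bound = begin
      ∣ S ∣                                 ≡⟨ trans (∣∣≡count S) (count-cycle+star s) ⟩
      count s (1 + 2 * k) + star-count s    ≤⟨ +-mono-≤ (cycle-bound cycle-surplus cycle-disjoint) (proj₁ star-bound) ⟩
      k + 2                                 ∎
      where open ≤-Reasoning

    excess-bound : ∣ S ∣ ≤ suc ∣ Nbhd (G k) S ∣ × (∣ S ∣ ≤ 2 ⊎ ∣ S ∣ ≤ ∣ Nbhd (G k) S ∣)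
    excess-bound rewrite ∣∣≡count S | ∣∣≡count (Nbhd (G k) S) | count-cycle+star s | count-cycle+star t =
      excess-bounds cycle-surplus (proj₁ star-bound) (proj₂ star-bound)

isEven : ℕ → Bool
isEven zero = true
isEven (suc n) = not (isEven n)

module IndependenceNumber {k} (2≤k : 2 ≤ k) where
  open Degrees 2≤k using (1≤k; order; <order)
  open Neighbourhoods 1≤k using (k<2k; +k<2k)
  open Gℕ k
  open Independence 2≤k

  -- Alternate vertices of 0 … k − 1, the opposite alternation on k … 2k − 1 (so that every chord
  -- i ~ i + k has exactly one end in W), and the two leaves.
  inW : ℕ → Bool
  inW i = if i <ᵇ k then isEven i else if i <ᵇ 2 * k then not (isEven (i ∸ k)) else 1 + 2 * k <ᵇ i

  inW-lower : ∀ {i} → i < k → inW i ≡ isEven i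
  inW-lower i<k rewrite <⇒<ᵇ-true i<k = refl

  inW-upper : ∀ {i} → k ≤ i → i < 2 * k → inW i ≡ not (isEven (i ∸ k))
  inW-upper k≤i i<2k rewrite ≤⇒<ᵇ-false k≤i | <⇒<ᵇ-true i<2k = refl

  inW-top : ∀ {i} → 2 * k ≤ i → inW i ≡ (1 + 2 * k <ᵇ i)
  inW-top 2k≤i rewrite ≤⇒<ᵇ-false (≤-trans (<⇒≤ k<2k) 2k≤i) | ≤⇒<ᵇ-false 2k≤i = refl

  inW-2k : inW (2 * k) ≡ false
  inW-2k = trans (inW-top ≤-refl) (≤⇒<ᵇ-false {1 + 2 * k} (n≤1+n _))

  inW-y : inW (1 + 2 * k) ≡ false
  inW-y = trans (inW-top (n≤1+n _)) (≤⇒<ᵇ-false {1 + 2 * k} ≤-refl)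

  no-arc : ∀ {i j} → Arc k i j → inW i ≡ true → inW j ≡ true → ⊥
  no-arc {i} (path refl i<2k) Wi W[1+i] with suc i <? k
  ... | yes 1+i<k = ≡true⇒≢false (trans (sym (inW-lower 1+i<k)) W[1+i])
                               (cong not (trans (sym (inW-lower (<-trans (n<1+n i) 1+i<k))) Wi))
  ... | no 1+i≮k with i <? k
  ... | yes i<k = ≡true⇒≢false W[1+i] (trans (inW-upper (≮⇒≥ 1+i≮k) (subst (_< 2 * k) (sym 1+i≡k) k<2k))
                                           (cong (not ∘ isEven) (trans (cong (_∸ k) 1+i≡k) (n∸n≡0 k))))
    where
    1+i≡k : suc i ≡ k
    1+i≡k = ≤-antisym i<k (≮⇒≥ 1+i≮k)
  ... | no i≮k with suc i <? 2 * k
  ... | yes 1+i<2k = ≡true⇒≢false (trans (sym (inW-upper (≮⇒≥ 1+i≮k) 1+i<2k)) W[1+i])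
                                (trans (cong (not ∘ isEven) (+-∸-assoc 1 (≮⇒≥ i≮k)))
                                       (cong not (trans (sym (inW-upper (≮⇒≥ i≮k) i<2k)) Wi)))
  ... | no 1+i≮2k = ≡true⇒≢false W[1+i] (trans (cong inW (≤-antisym i<2k (≮⇒≥ 1+i≮2k))) inW-2k)
  no-arc (close refl refl) _ W2k = ≡true⇒≢false W2k inW-2k
  no-arc {i} (chord i<k refl) Wi Wj = ≡true⇒≢false (trans (sym (inW-upper (m≤n+m k i) (+k<2k i<k))) Wj)
    (cong not (trans (cong isEven (m+n∸n≡m i k)) (trans (sym (inW-lower i<k)) Wi)))
  no-arc (spoke refl refl) W2k _ = ≡true⇒≢false W2k inW-2k
  no-arc (leaf₁ refl refl) Wy _ = ≡true⇒≢false Wy inW-y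
  no-arc (leaf₂ refl refl) Wy _ = ≡true⇒≢false Wy inW-y

  W : Subset order
  W = tabulated inW

  count-inW-cycle : count inW (2 * k) ≡ k
  count-inW-cycle = begin
    count inW (2 * k)                                  ≡⟨ cong (count inW) (cong (k +_) (+-identityʳ k)) ⟩
    count inW (k + k)                                  ≡⟨ count-split inW k k ⟩
    count inW k + count (inW ∘ (k +_)) k               ≡⟨ cong₂ _+_ (count-cong k inW-lower) (count-cong k upper) ⟩
    count isEven k + count (not ∘ isEven) k            ≡⟨ count-complement isEven k ⟩
    k                                                  ∎
    where
    open ≡-Reasoning
    upper : ∀ {i} → i < k → inW (k + i) ≡ not (isEven i)
    upper {i} i<k = trans (inW-upper (m≤m+n k i) (subst (_< 2 * k) (+-comm i k) (+k<2k i<k)))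
                          (cong (not ∘ isEven) (m+n∸m≡n k i))

  W-size : ∣ W ∣ ≡ k + 2
  W-size = begin
    ∣ W ∣                                                  ≡⟨ ∣tabulated∣ inW ⟩
    count inW order                                        ≡⟨ count-cycle+star inW ⟩
    count inW (1 + 2 * k) + star-count inW                 ≡⟨ cong (_+ star-count inW) (count-last inW (2 * k)) ⟩
    count inW (2 * k) + χ (inW (2 * k)) + star-count inW   ≡⟨ cong₂ (λ c b → c + χ b + star-count inW) count-inW-cycle inW-2k ⟩
    k + 0 + star-count inW                                 ≡⟨ cong₂ _+_ (+-identityʳ k) star≡2 ⟩
    k + 2                                                  ∎
    where
    open ≡-Reasoning
    star≡2 : star-count inW ≡ 2
    star≡2 rewrite inW-y | inW-top (≤-trans (n≤1+n _) (n≤1+n _))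
                 | inW-top (≤-trans (n≤1+n _) (≤-trans (n≤1+n _) (n≤1+n _)))
                 | <⇒<ᵇ-true (n<1+n (1 + 2 * k)) | <⇒<ᵇ-true (m<n⇒m<1+n (n<1+n (1 + 2 * k))) = refl

  independence-number : IsIndependenceNumber (G k) (k + 2)
  independence-number = (W , tabulated-independent inW no-arc , W-size) , λ S indep → size-bound indep

module Criticality {k} (2≤k : 2 ≤ k) where
  open Degrees 2≤k using (1≤k; order; <order; beyond-y)
  open Neighbourhoods 1≤k using (neighbours-x₁; neighbours-x₂)
  open Gℕ k
  open Independence 2≤k

  inL : ℕ → Bool
  inL i = 1 + 2 * k <ᵇ i

  L : Subset order
  L = tabulated inL

  leaf-neighbour : ∀ {i j} → inL i ≡ true → Edge k i j → j ≡ 1 + 2 * k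
  leaf-neighbour {i} y<i edge with beyond-y (<ᵇ⇒< _ _ (T-≡ .from y<i)) (<order (Edge⇒≤ 1≤k (swap edge)))
  ... | inj₁ refl = singleton⁻ (proj₁ neighbours-x₁ edge)
  ... | inj₂ refl = singleton⁻ (proj₁ neighbours-x₂ edge)

  L-independent : Independent (G k) L
  L-independent = tabulated-independent inL (λ arc Li Lj →
    ≡true⇒≢false Lj (subst (λ j → inL j ≡ false) (sym (leaf-neighbour Li (inj₁ arc))) (≤⇒<ᵇ-false {1 + 2 * k} ≤-refl)))

  L-size : ∣ L ∣ ≡ 2
  L-size = begin
    ∣ L ∣                                ≡⟨ ∣tabulated∣ inL ⟩
    count inL order                      ≡⟨ count-cycle+star inL ⟩
    count inL (1 + 2 * k) + star-count inL
      ≡⟨ cong₂ _+_ (count-none (1 + 2 * k) (λ i<1+2k → ≤⇒<ᵇ-false (<⇒≤ i<1+2k))) star≡2 ⟩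
    2                                    ∎
    where
    open ≡-Reasoning
    star≡2 : star-count inL ≡ 2
    star≡2 rewrite ≤⇒<ᵇ-false {1 + 2 * k} ≤-refl | <⇒<ᵇ-true (n<1+n (1 + 2 * k))
                 | <⇒<ᵇ-true (m<n⇒m<1+n (n<1+n (1 + 2 * k))) = refl

  Nbhd-L-size : ∣ Nbhd (G k) L ∣ ≤ 1
  Nbhd-L-size = begin
    ∣ Nbhd (G k) L ∣                     ≡⟨ ∣∣≡count (Nbhd (G k) L) ⟩
    count (at (Nbhd (G k) L)) order      ≤⟨ count-mono {at (Nbhd (G k) L)} {_≡ᵇ 1 + 2 * k} order only-y ⟩
    count (_≡ᵇ 1 + 2 * k) order          ≡⟨ count-point order (<order (≤-trans (n≤1+n _) (n≤1+n _))) ⟩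
    1                                    ∎
    where
    open ≤-Reasoning
    only-y : ∀ {j} → j < order → at (Nbhd (G k) L) j ≡ true → (j ≡ᵇ 1 + 2 * k) ≡ true
    only-y {j} _ Nj = ≡⇒≡ᵇ-true {j} {1 + 2 * k} (leaf-neighbour {i} {j} (at-tabulated inL Li) (adj⇒Edge {k} {i} {j} i~j))
      where
      i = proj₁ (Nbhd-elim L Nj)
      Li : at L i ≡ true
      Li = proj₁ (proj₂ (Nbhd-elim L Nj))
      i~j : adj k i j ≡ true
      i~j = proj₂ (proj₂ (Nbhd-elim L Nj))


  L-critical : ∀ J → Independent (G k) J → excess (G k) J ℤ.≤ excess (G k) L
  L-critical J indep = m-n≤o-p {∣ J ∣} {∣ Nbhd (G k) J ∣} {∣ L ∣} {∣ Nbhd (G k) L ∣} (begin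
    ∣ J ∣ + ∣ Nbhd (G k) L ∣        ≤⟨ +-mono-≤ (proj₁ (excess-bound indep)) Nbhd-L-size ⟩
    suc ∣ Nbhd (G k) J ∣ + 1        ≡⟨ +-comm (suc ∣ Nbhd (G k) J ∣) 1 ⟩
    2 + ∣ Nbhd (G k) J ∣            ≡⟨ cong (_+ ∣ Nbhd (G k) J ∣) (sym L-size) ⟩
    ∣ L ∣ + ∣ Nbhd (G k) J ∣        ∎)
    where open ≤-Reasoning

  critical-size : ∀ J → Critical (G k) J → ∣ J ∣ ≤ 2
  critical-size J (indep , J-critical) with proj₂ (excess-bound indep)
  ... | inj₁ J≤2 = J≤2
  ... | inj₂ J≤NJ = ⊥-elim (ℤ.<⇒≱ (m-n<o-p {∣ J ∣} {∣ Nbhd (G k) J ∣} {∣ L ∣} {∣ Nbhd (G k) L ∣} (begin-strict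
    ∣ J ∣ + ∣ Nbhd (G k) L ∣        ≤⟨ +-mono-≤ J≤NJ Nbhd-L-size ⟩
    ∣ Nbhd (G k) J ∣ + 1            <⟨ +-monoʳ-< ∣ Nbhd (G k) J ∣ (n<1+n 1) ⟩
    ∣ Nbhd (G k) J ∣ + 2            ≡⟨ +-comm _ 2 ⟩
    2 + ∣ Nbhd (G k) J ∣            ≡⟨ cong (_+ ∣ Nbhd (G k) J ∣) (sym L-size) ⟩
    ∣ L ∣ + ∣ Nbhd (G k) J ∣        ∎)) (J-critical L L-independent))
    where open ≤-Reasoning

  critical-independence-number : IsCriticalIndependenceNumber (G k) 2
  critical-independence-number = (L , (L-independent , L-critical) , L-size) , critical-size

module Connectivity {k} (2≤k : 2 ≤ k) where
  open Degrees 2≤k using (1≤k; order; <order; beyond-y)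
  open Gℕ k

  root : Fin order
  root = vertex (<order z≤n)

  reach-cycle : ∀ {i} (i<order : i < order) → i ≤ 1 + 2 * k → Reach (G k) root (vertex i<order)
  reach-cycle {zero} _ _ = here
  reach-cycle {suc i} 1+i<order 1+i≤1+2k =
    Reach-step i<order 1+i<order (reach-cycle i<order (<⇒≤ 1+i≤1+2k)) (Edge⇒adj 1≤k (inj₁ arc))
    where
    i<order = <-trans (n<1+n i) 1+i<order
    arc : Arc k i (suc i)
    arc with i <? 2 * k
    ... | yes i<2k = path refl i<2k
    ... | no i≮2k = spoke i≡2k (cong suc i≡2k)
      where i≡2k = ≤-antisym (s≤s⁻¹ 1+i≤1+2k) (≮⇒≥ i≮2k)

  reach : ∀ {i} (i<order : i < order) → Reach (G k) root (vertex i<order)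
  reach {i} i<order with i ≤? 1 + 2 * k
  ... | yes i≤1+2k = reach-cycle i<order i≤1+2k
  ... | no i≰1+2k = Reach-step y<order i<order (reach-cycle y<order ≤-refl) (Edge⇒adj 1≤k (inj₁ leaf))
    where
    y<order = <order (≤-trans (n≤1+n _) (n≤1+n _))
    leaf : Arc k (1 + 2 * k) i
    leaf with beyond-y (≰⇒> i≰1+2k) i<order
    ... | inj₁ i≡x₁ = leaf₁ refl i≡x₁
    ... | inj₂ i≡x₂ = leaf₂ refl i≡x₂

  connected : Connected (G k)
  connected = connected-from-root (G k) root (Reach-all reach)

G-properties : ∀ k → 2 ≤ k →
    Connected (G k) × IsIndependenceNumber (G k) (k + 2) × IsAnnihilationNumber (G k) (k + 2)
  × 2 * k + 4 ≤ 2 * (k + 2) × IsCriticalIndependenceNumber (G k) 2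
G-properties k 2≤k =
    Connectivity.connected 2≤k
  , IndependenceNumber.independence-number 2≤k
  , Annihilation.annihilation 2≤k
  , ≤-reflexive (sym (*-distribˡ-+ 2 k 2))
  , Criticality.critical-independence-number 2≤k

mainTheorem2 :
    (∀ (k : ℕ) → 2 ≤ k →
        Connected (G k)
      × IsIndependenceNumber (G k) (k + 2)
      × IsAnnihilationNumber (G k) (k + 2)
      × 2 * k + 4 ≤ 2 * (k + 2)
      × IsCriticalIndependenceNumber (G k) 2)
    × (∃ λ n → Σ (Graph n) λ H → ∃ λ a → ∃ λ α → ∃ λ α' →
          Connected H × IsAnnihilationNumber H a × IsIndependenceNumber H α
        × IsCriticalIndependenceNumber H α' × n ≤ 2 * a × α ≡ a × α' ≢ a)
    × (∀ (m : ℕ) → ∃ λ n → Σ (Graph n) λ H → ∃ λ α → ∃ λ α' →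
          Connected H × IsIndependenceNumber H α
        × IsCriticalIndependenceNumber H α' × m ≤ α ∸ α')
mainTheorem2 =
    G-properties
  , (let connected , α , a , n≤2a , α′ = G-properties 2 ≤-refl
     in 8 , G 2 , 4 , 4 , 2 , connected , a , α , α′ , n≤2a , refl , λ ())
  , λ m → let connected , α , _ , _ , α′ = G-properties (m + 2) (m≤n+m 2 m)
          in _ , G (m + 2) , m + 2 + 2 , 2 , connected , α , α′
           , ≤-trans (m≤m+n m 2) (≤-reflexive (sym (m+n∸n≡m (m + 2) 2)))
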